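{- Let $\nu\subseteq\mu\subset\lambda$ be Young diagrams with $\mu\nearrow\lambda$, such that the skew diagram $\lambda/\nu$ has $n$ boxes and is a broken border strip. Let $d_1,\dots,d_m$ be the labels (in the standard labelling of $\lambda/\nu$) of the dull boxes of $\lambda/\nu$, with $d_i$ the label of the box $\lambda/\mu$, and let $s_1,\dots,s_l$ be the labels of the sharp corners of $\lambda/\nu$. Then, as rational functions in indeterminates $x_1,\dots,x_n$, $$X_{\lambda/\nu,\mu/\nu}(x_1,\dots,x_n)=\frac{\prod_{j=1}^l(x_{d_i}-x_{s_j})}{\prod_{j=1,\,j\ne i}^m(x_{d_i}-x_{d_j})}\cdot\frac{1}{\prod_{R_{\lambda/\nu}}(x_j-x_i)\prod_{C_{\lambda/\nu}}(x_j-x_i)},$$ where $R_{\lambda/\nu}$ (resp. $C_{\lambda/\nu}$) is the set of pairs of labels $i<j$ whose boxes are adjacent in some row (resp. column) of $\lambda/\nu$.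
   Context: Young diagrams are identified with partitions; $\mu\nearrow\lambda$ means $\lambda$ is obtained from $\mu$ by adding one box. The standard labelling of a skew diagram $\lambda/\nu$ with $n$ boxes labels its boxes $1,\dots,n$ from left to right in each row, starting with the top row and proceeding downward. A broken border strip is a skew diagram containing no $2\times 2$ block of boxes. A sharp corner is a box of $\lambda/\nu$ having a box of $\lambda/\nu$ directly below it and one directly to its right; a dull box is a box of $\lambda/\nu$ with no box of $\lambda/\nu$ directly to its right and none directly below. Let $\ell$ be the label of the box $\lambda/\mu$. A standard tableau of shape $\mu/\nu$ is a filling of $\mu/\nu$ with $1,\dots,n-1$ increasing along rows and down columns; $\mathrm{SYT}(\mu/\nu)$ is their set. Each $T\in\mathrm{SYT}(\mu/\nu)$ is regarded as the bijection $T:\{1,\dots,n\}\setminus\{\ell\}\to\{1,\dots,n-1\}$ sending a label to the entry of $T$ in the box with that label. Define $X_{\lambda/\nu,\mu/\nu}(x_1,\dots,x_n)=\sum_{T\in\mathrm{SYT}(\mu/\nu)}\frac{1}{[x_{T^{ -1}(2)}-x_{T^{ -1}(1)}]\cdots[x_{T^{ -1}(n-1)}-x_{T^{ -1}(n-2)}]\,[x_{\ell}-x_{T^{ -1}(n-1)}]}$. -}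

module Defs where

open import Data.Nat as ℕ using (ℕ; zero; suc; _≤_; _<_; _≤ᵇ_; _<ᵇ_)
open import Data.Bool using (Bool; true; false; _∧_; _∨_; not; if_then_else_)
open import Data.Product using (_×_; _,_; proj₁; proj₂; Σ; ∃)
open import Data.Product.Properties using (≡-dec)
open import Data.List using (List; []; _∷_; _++_; map; concatMap; upTo; length; filter; foldr)
import Data.List.Relation.Unary.All as All
open import Relation.Binary.PropositionalEquality using (_≡_; _≢_)
open import Relation.Nullary using (¬_; yes; no; Dec; does)
open import Data.Rational as ℚ using (ℚ; 0ℚ; 1ℚ; _-_; _*_; _+_; 1/_; ≢-nonZero)
import Data.Rational.Properties as ℚP

-- A partition (Young diagram) is a list of row lengths λ₀ ≥ λ₁ ≥ … > 0.
-- Rows are indexed from 0 (top row); row λ r = 0 beyond the last row.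
row : List ℕ → ℕ → ℕ
row []       _       = 0
row (a ∷ _)  zero    = a
row (_ ∷ as) (suc r) = row as r

IsPartition : List ℕ → Set
IsPartition λ′ = (∀ r → row λ′ (suc r) ≤ row λ′ r) × All.All (λ k → 0 < k) λ′

_⊆Y_ : List ℕ → List ℕ → Set
ν ⊆Y μ = ∀ r → row ν r ≤ row μ r

-- μ ↗ λ with the added box in row r (so the box λ/μ is (r , row μ r))
AddsBoxAt : List ℕ → List ℕ → ℕ → Set
AddsBoxAt μ λ′ r = (row λ′ r ≡ suc (row μ r)) × (∀ r′ → r′ ≢ r → row λ′ r′ ≡ row μ r′)

-- Boxes of a skew diagram, coordinates (row , column), 0-based

Box : Set
Box = ℕ × ℕ

_≟B_ : (a b : Box) → Dec (a ≡ b)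
_≟B_ = ≡-dec ℕ._≟_ ℕ._≟_

InSkew : List ℕ → List ℕ → Box → Set
InSkew λ′ ν (r , c) = (row ν r ≤ c) × (c < row λ′ r)

inSkewᵇ : List ℕ → List ℕ → Box → Bool
inSkewᵇ λ′ ν (r , c) = (row ν r ≤ᵇ c) ∧ (c <ᵇ row λ′ r)

range : ℕ → ℕ → List ℕ
range a b = map (a ℕ.+_) (upTo (b ℕ.∸ a))

-- boxes of λ/ν in the order of the standard labelling:
-- rows top to bottom, each row left to right
boxes : List ℕ → List ℕ → List Box
boxes λ′ ν = concatMap (λ r → map (r ,_) (range (row ν r) (row λ′ r))) (upTo (length λ′))

-- position (1-based) of a box in a list; 0 if absent
pos : List Box → Box → ℕ
pos []       b = 0
pos (a ∷ as) b with a ≟B b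
... | yes _ = 1
... | no  _ with pos as b
...   | zero  = 0
...   | suc k = suc (suc k)

label : List ℕ → List ℕ → Box → ℕ
label λ′ ν b = pos (boxes λ′ ν) b

right below : Box → Box
right (r , c) = (r , suc c)
below (r , c) = (suc r , c)

BrokenBorderStrip : List ℕ → List ℕ → Set
BrokenBorderStrip λ′ ν = ∀ r c →
  ¬ (InSkew λ′ ν (r , c) × InSkew λ′ ν (r , suc c)
     × InSkew λ′ ν (suc r , c) × InSkew λ′ ν (suc r , suc c))

sharpᵇ : List ℕ → List ℕ → Box → Bool
sharpᵇ λ′ ν b = inSkewᵇ λ′ ν (below b) ∧ inSkewᵇ λ′ ν (right b)

dullᵇ : List ℕ → List ℕ → Box → Bool
dullᵇ λ′ ν b = not (inSkewᵇ λ′ ν (right b)) ∧ not (inSkewᵇ λ′ ν (below b))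

filterᵇ : {A : Set} → (A → Bool) → List A → List A
filterᵇ p []       = []
filterᵇ p (x ∷ xs) = if p x then x ∷ filterᵇ p xs else filterᵇ p xs

sharpLabels dullLabels : List ℕ → List ℕ → List ℕ
sharpLabels λ′ ν = map (label λ′ ν) (filterᵇ (sharpᵇ λ′ ν) (boxes λ′ ν))
dullLabels  λ′ ν = map (label λ′ ν) (filterᵇ (dullᵇ  λ′ ν) (boxes λ′ ν))

rowPairs colPairs : List ℕ → List ℕ → List (ℕ × ℕ)
rowPairs λ′ ν = map (λ b → label λ′ ν b , label λ′ ν (right b))
                    (filterᵇ (λ b → inSkewᵇ λ′ ν (right b)) (boxes λ′ ν))
colPairs λ′ ν = map (λ b → label λ′ ν b , label λ′ ν (below b))
                    (filterᵇ (λ b → inSkewᵇ λ′ ν (below b)) (boxes λ′ ν))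

inserts : {A : Set} → A → List A → List (List A)
inserts x []       = (x ∷ []) ∷ []
inserts x (y ∷ ys) = (x ∷ y ∷ ys) ∷ map (y ∷_) (inserts x ys)

perms : {A : Set} → List A → List (List A)
perms []       = [] ∷ []
perms (x ∷ xs) = concatMap (inserts x) (perms xs)

-- A standard tableau T of shape μ/ν is encoded by the list
-- w = [T⁻¹(1) , … , T⁻¹(n-1)] of boxes of μ/ν ordered by their entries
-- (w is an ordering of all boxes of μ/ν).
isStandardᵇ : List ℕ → List ℕ → List Box → Bool
isStandardᵇ μ ν w = allᵇ (boxes μ ν)
  where
  ok : Box → Bool
  ok b = (not (inSkewᵇ μ ν (right b)) ∨ (pos w b <ᵇ pos w (right b)))
       ∧ (not (inSkewᵇ μ ν (below b)) ∨ (pos w b <ᵇ pos w (below b)))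
  allᵇ : List Box → Bool
  allᵇ []       = true
  allᵇ (b ∷ bs) = ok b ∧ allᵇ bs

SYT : List ℕ → List ℕ → List (List Box)
SYT μ ν = filterᵇ (isStandardᵇ μ ν) (perms (boxes μ ν))

-- total inverse on ℚ (only ever applied to nonzero arguments below,
-- because the indeterminates are evaluated at pairwise distinct points)
inv : ℚ → ℚ
inv q with q ℚP.≟ 0ℚ
... | yes _ = 0ℚ
... | no q≢0 = 1/_ q {{≢-nonZero q≢0}}

sumℚ prodℚ : List ℚ → ℚ
sumℚ  = foldr _+_ 0ℚ
prodℚ = foldr _*_ 1ℚ

chainProd : (ℕ → ℚ) → List ℕ → ℚ
chainProd x []           = 1ℚ
chainProd x (a ∷ [])     = 1ℚ
chainProd x (a ∷ b ∷ as) = (x b - x a) * chainProd x (b ∷ as)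

-- X_{λ/ν, μ/ν}(x₁ … xₙ), ℓ the label of the box λ/μ
X : List ℕ → List ℕ → List ℕ → ℕ → (ℕ → ℚ) → ℚ
X λ′ μ ν ℓ x =
  sumℚ (map (λ w → inv (chainProd x (map (label λ′ ν) w ++ (ℓ ∷ [])))) (SYT μ ν))

RHS : List ℕ → List ℕ → ℕ → (ℕ → ℚ) → ℚ
RHS λ′ ν ℓ x =
  (prodℚ (map (λ s → x ℓ - x s) (sharpLabels λ′ ν))
   * inv (prodℚ (map (λ d → x ℓ - x d)
                     (filterᵇ (λ d → not (d ℕ.≡ᵇ ℓ)) (dullLabels λ′ ν)))))
  * inv (prodℚ (map (λ p → x (proj₂ p) - x (proj₁ p)) (rowPairs λ′ ν))
         * prodℚ (map (λ p → x (proj₂ p) - x (proj₁ p)) (colPairs λ′ ν)))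

-- Sort the standard tableaux of μ/ν by the box c holding their largest entry: c is a dull box
-- of μ/ν and removing it leaves a standard tableau of a smaller shape, while the chain of
-- differences gains the factor x_ℓ − x_c.  By induction on the number of boxes, X is therefore
-- Σ_c RHS(μ/ν, c) / (x_ℓ − x_c).  A broken border strip has fewer sharp corners than dull boxes,
-- so this sum is the partial-fraction expansion of ∏_s (t − x_s) / ∏_d (t − x_d) at t = x_ℓ
-- (divided by the row and column factors of μ/ν).  Putting the box ℓ back changes the sharp,
-- dull and adjacency factors only at its left and upper neighbours, where the changes cancel,
-- and what remains is RHS(λ/ν, ℓ).

module Submission where

open import Defs
open import Data.Nat using (ℕ; _≤_; suc)
open import Data.List using (List; length)
open import Data.Rational using (ℚ)
open import Data.Product using (_,_)
open import Relation.Binary.PropositionalEquality using (_≡_; _≢_)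

open import Data.Nat as ℕ using (zero; _<_; _≤ᵇ_; _<ᵇ_; s≤s; z≤n; _∸_; pred)
import Data.Nat.Properties as ℕP
open import Data.Bool using (Bool; true; false; _∧_; _∨_; not; if_then_else_)
open import Data.Bool.Properties using (T-≡; T-not-≡; T-∧; ∧-zeroʳ; ∧-identityʳ)
open import Data.Bool.ListAction using (all; and)
open import Data.Product using (_×_; proj₁; proj₂; ∃; map₁; map₂)
open import Data.List using ([]; _∷_; _++_; map; concatMap; upTo)
open import Data.List.Properties
  using (map-++; map-∘; ++-assoc; ++-identityʳ; map-cong; map-cong-local; concatMap-cong; concatMap-++;
         upTo-∷ʳ; length-++; foldr-universal; foldr-map)
open import Data.List.Membership.Propositional using (_∈_; _∉_; find; lose)
open import Data.List.Membership.Propositional.Properties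
  using (∈-map⁺; ∈-map⁻; ∈-concatMap⁺; ∈-concatMap⁻; ∈-upTo⁺; ∈-upTo⁻; ∈-length)
open import Data.List.Relation.Unary.Any using (here; there)
open import Data.List.Relation.Unary.All as All using ([]; _∷_)
import Data.List.Relation.Unary.All.Properties as All
open import Data.List.Relation.Unary.Unique.Propositional using (Unique; []; _∷_)
import Data.List.Relation.Unary.Unique.Propositional.Properties as Unique
import Data.List.Relation.Unary.AllPairs as AllPairs
import Data.List.Relation.Unary.AllPairs.Properties as AllPairs
open import Data.List.Relation.Binary.Disjoint.Propositional using (Disjoint)
open import Data.List.Relation.Binary.Permutation.Propositional using (_↭_; ↭-refl; ↭-prep; ↭-swap; ↭-trans; ↭-sym)
open import Data.List.Relation.Binary.Permutation.Propositional.Properties using (∈-resp-↭)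
open import Data.Empty using (⊥-elim)
open import Function using (_∘_)
open import Function.Bundles using (Equivalence; _⇔_; mk⇔)
open Equivalence using (to; from)
open import Relation.Binary.PropositionalEquality using (refl; sym; trans; cong; cong₂; subst; ≢-sym; module ≡-Reasoning)
open import Relation.Nullary using (¬_; yes; no; Dec; does; proof)
open import Relation.Nullary.Decidable using (dec-true; dec-false; does-⇔; _×-dec_; ¬?)
open import Relation.Nullary.Reflects using (Reflects; invert)
open import Data.Rational using (0ℚ; 1ℚ; _-_; _*_; _+_; -_; ≢-nonZero)
import Data.Rational.Properties as ℚP
open import Data.Rational.Solver using (module +-*-Solver)
open +-*-Solver using (solve; _:+_; _:-_; _:*_; :-_; _:=_; con)
open ≡-Reasoning

*-inv : ∀ q → q ≢ 0ℚ → q * inv q ≡ 1ℚ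
*-inv q q≢0 with q ℚP.≟ 0ℚ
... | yes q≡0  = ⊥-elim (q≢0 q≡0)
... | no  q≢0′ = ℚP.*-inverseʳ q {{≢-nonZero q≢0′}}

inv-unique : ∀ q u v → q * u ≡ 1ℚ → q * v ≡ 1ℚ → u ≡ v
inv-unique q u v qu≡1 qv≡1 = begin
  u             ≡⟨ ℚP.*-identityʳ u ⟨
  u * 1ℚ        ≡⟨ cong (u *_) qv≡1 ⟨
  u * (q * v)   ≡⟨ solve 3 (λ q u v → u :* (q :* v) := (q :* u) :* v) refl q u v ⟩
  (q * u) * v   ≡⟨ cong (_* v) qu≡1 ⟩
  1ℚ * v        ≡⟨ ℚP.*-identityˡ v ⟩
  v             ∎

*≢0 : ∀ {p q} → p ≢ 0ℚ → q ≢ 0ℚ → p * q ≢ 0ℚ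
*≢0 {p} {q} p≢0 q≢0 pq≡0 = q≢0 (begin
  q                  ≡⟨ ℚP.*-identityˡ q ⟨
  1ℚ * q             ≡⟨ cong (_* q) (trans (ℚP.*-comm (inv p) p) (*-inv p p≢0)) ⟨
  (inv p * p) * q    ≡⟨ ℚP.*-assoc (inv p) p q ⟩
  inv p * (p * q)    ≡⟨ cong (inv p *_) pq≡0 ⟩
  inv p * 0ℚ         ≡⟨ ℚP.*-zeroʳ (inv p) ⟩
  0ℚ                 ∎)

-- Also when p or q is 0, since inv 0ℚ = 0ℚ.
inv-* : ∀ p q → inv (p * q) ≡ inv p * inv q
inv-* p q = by-cases (p ℚP.≟ 0ℚ) (q ℚP.≟ 0ℚ)
  where
  by-cases : Dec (p ≡ 0ℚ) → Dec (q ≡ 0ℚ) → inv (p * q) ≡ inv p * inv q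
  by-cases (yes refl) _          = trans (cong inv (ℚP.*-zeroˡ q)) (sym (ℚP.*-zeroˡ (inv q)))
  by-cases (no _)     (yes refl) = trans (cong inv (ℚP.*-zeroʳ p)) (sym (ℚP.*-zeroʳ (inv p)))
  by-cases (no p≢0)   (no q≢0)   = inv-unique (p * q) _ _ (*-inv (p * q) (*≢0 p≢0 q≢0)) (begin
    p * q * (inv p * inv q)      ≡⟨ solve 4 (λ p q p′ q′ → p :* q :* (p′ :* q′) := (p :* p′) :* (q :* q′))
                                          refl p q (inv p) (inv q) ⟩
    (p * inv p) * (q * inv q)    ≡⟨ cong₂ _*_ (*-inv p p≢0) (*-inv q q≢0) ⟩
    1ℚ                           ∎)

inv-neg : ∀ q → inv (- q) ≡ - inv q
inv-neg q = by-cases (q ℚP.≟ 0ℚ)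
  where
  by-cases : Dec (q ≡ 0ℚ) → inv (- q) ≡ - inv q
  by-cases (yes refl) = refl
  by-cases (no q≢0)   = inv-unique (- q) _ _ (*-inv (- q) (q≢0 ∘ ℚP.neg-injective))
    (trans (solve 2 (λ q q′ → (:- q) :* (:- q′) := q :* q′) refl q (inv q)) (*-inv q q≢0))

p≢q⇒p-q≢0 : ∀ {a b} → a ≢ b → a - b ≢ 0ℚ
p≢q⇒p-q≢0 {a} {b} a≢b a-b≡0 = a≢b (begin
  a              ≡⟨ solve 2 (λ a b → a := (a :- b) :+ b) refl a b ⟩
  (a - b) + b    ≡⟨ cong (_+ b) a-b≡0 ⟩
  0ℚ + b         ≡⟨ ℚP.+-identityˡ b ⟩
  b              ∎)

*-inv-cancelˡ : ∀ {q} r → q ≢ 0ℚ → q * inv (q * r) ≡ inv r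
*-inv-cancelˡ {q} r q≢0 = begin
  q * inv (q * r)        ≡⟨ cong (q *_) (inv-* q r) ⟩
  q * (inv q * inv r)    ≡⟨ ℚP.*-assoc q (inv q) (inv r) ⟨
  (q * inv q) * inv r    ≡⟨ cong (_* inv r) (*-inv q q≢0) ⟩
  1ℚ * inv r             ≡⟨ ℚP.*-identityˡ (inv r) ⟩
  inv r                  ∎

partial-fractions : ∀ {a b t} → a ≢ b → t ≢ a → t ≢ b →
  inv (a - b) * inv (t - a) ≡ inv (t - b) * (inv (t - a) - inv (b - a))
partial-fractions {a} {b} {t} a≢b t≢a t≢b = begin
  u * v                                          ≡⟨ ℚP.*-identityˡ (u * v) ⟨
  1ℚ * (u * v)                                   ≡⟨ cong (_* (u * v)) (*-inv (t - b) (p≢q⇒p-q≢0 t≢b)) ⟨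
  ((t - b) * w) * (u * v)                        ≡⟨ solve 6 (λ t b w u v a →
                                                      ((t :- b) :* w) :* (u :* v)
                                                      := w :* (((t :- a) :* v) :* u :+ ((a :- b) :* u) :* v))
                                                    refl t b w u v a ⟩
  w * (((t - a) * v) * u + ((a - b) * u) * v)    ≡⟨ cong₂ (λ p q → w * (p * u + q * v))
                                                      (*-inv (t - a) (p≢q⇒p-q≢0 t≢a)) (*-inv (a - b) (p≢q⇒p-q≢0 a≢b)) ⟩
  w * (1ℚ * u + 1ℚ * v)                          ≡⟨ cong (w *_) (solve 2 (λ u v → con 1ℚ :* u :+ con 1ℚ :* v := v :- (:- u))
                                                      refl u v) ⟩
  w * (v - (- u))                                ≡⟨ cong (λ z → w * (v - z)) inv[b-a]≡-u ⟨
  w * (v - inv (b - a))                          ∎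
  where
  u = inv (a - b)
  v = inv (t - a)
  w = inv (t - b)
  inv[b-a]≡-u : inv (b - a) ≡ - u
  inv[b-a]≡-u = trans (cong inv (solve 2 (λ a b → b :- a := :- (a :- b)) refl a b)) (inv-neg (a - b))

private
  variable
    A : Set

sumℚ-++ : ∀ xs ys → sumℚ (xs ++ ys) ≡ sumℚ xs + sumℚ ys
sumℚ-++ []       ys = sym (ℚP.+-identityˡ _)
sumℚ-++ (x ∷ xs) ys = trans (cong (x +_) (sumℚ-++ xs ys)) (sym (ℚP.+-assoc x _ _))

sumℚ-cong : ∀ {f g : A → ℚ} xs → (∀ {x} → x ∈ xs → f x ≡ g x) → sumℚ (map f xs) ≡ sumℚ (map g xs)
sumℚ-cong xs f≡g = cong sumℚ (map-cong-local (All.tabulate f≡g))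

prodℚ-cong : ∀ {f g : A → ℚ} xs → (∀ {x} → x ∈ xs → f x ≡ g x) → prodℚ (map f xs) ≡ prodℚ (map g xs)
prodℚ-cong xs f≡g = cong prodℚ (map-cong-local (All.tabulate f≡g))

sumℚ-zero : ∀ (f : A → ℚ) xs → (∀ {x} → x ∈ xs → f x ≡ 0ℚ) → sumℚ (map f xs) ≡ 0ℚ
sumℚ-zero f []       f≡0 = refl
sumℚ-zero f (x ∷ xs) f≡0 =
  trans (cong₂ _+_ (f≡0 (here refl)) (sumℚ-zero f xs (f≡0 ∘ there))) (ℚP.+-identityˡ 0ℚ)

sumℚ-+ : ∀ (f g : A → ℚ) xs → sumℚ (map (λ x → f x + g x) xs) ≡ sumℚ (map f xs) + sumℚ (map g xs)
sumℚ-+ f g []       = refl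
sumℚ-+ f g (x ∷ xs) = trans (cong (f x + g x +_) (sumℚ-+ f g xs))
  (solve 4 (λ a b c d → a :+ b :+ (c :+ d) := a :+ c :+ (b :+ d)) refl (f x) (g x) _ _)

sumℚ-neg : ∀ (f : A → ℚ) xs → sumℚ (map (λ x → - f x) xs) ≡ - sumℚ (map f xs)
sumℚ-neg f []       = refl
sumℚ-neg f (x ∷ xs) = trans (cong (- f x +_) (sumℚ-neg f xs)) (sym (ℚP.neg-distrib-+ (f x) _))

*-sumℚ : ∀ c (f : A → ℚ) xs → c * sumℚ (map f xs) ≡ sumℚ (map (λ x → c * f x) xs)
*-sumℚ c f []       = ℚP.*-zeroʳ c
*-sumℚ c f (x ∷ xs) = trans (ℚP.*-distribˡ-+ c (f x) _) (cong (c * f x +_) (*-sumℚ c f xs))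

sumℚ-* : ∀ c (f : A → ℚ) xs → sumℚ (map (λ x → f x * c) xs) ≡ sumℚ (map f xs) * c
sumℚ-* c f xs = begin
  sumℚ (map (λ x → f x * c) xs)   ≡⟨ cong sumℚ (map-cong-local (All.universal (λ x → ℚP.*-comm (f x) c) xs)) ⟩
  sumℚ (map (λ x → c * f x) xs)   ≡⟨ *-sumℚ c f xs ⟨
  c * sumℚ (map f xs)             ≡⟨ ℚP.*-comm c _ ⟩
  sumℚ (map f xs) * c             ∎

prodℚ-* : ∀ (f g : A → ℚ) xs → prodℚ (map (λ x → f x * g x) xs) ≡ prodℚ (map f xs) * prodℚ (map g xs)
prodℚ-* f g []       = refl
prodℚ-* f g (x ∷ xs) = trans (cong (f x * g x *_) (prodℚ-* f g xs))
  (solve 4 (λ a b c d → a :* b :* (c :* d) := a :* c :* (b :* d)) refl (f x) (g x) _ _)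

inv-prodℚ : ∀ (f : A → ℚ) xs → inv (prodℚ (map f xs)) ≡ prodℚ (map (inv ∘ f) xs)
inv-prodℚ f []       = refl
inv-prodℚ f (x ∷ xs) = trans (inv-* (f x) _) (cong (inv (f x) *_) (inv-prodℚ f xs))

sumℚ-concatMap : ∀ {B : Set} (f : B → ℚ) (F : A → List B) xs →
  sumℚ (map f (concatMap F xs)) ≡ sumℚ (map (λ x → sumℚ (map f (F x))) xs)
sumℚ-concatMap f F []       = refl
sumℚ-concatMap f F (x ∷ xs) = begin
  sumℚ (map f (F x ++ concatMap F xs))                ≡⟨ cong sumℚ (map-++ f (F x) _) ⟩
  sumℚ (map f (F x) ++ map f (concatMap F xs))        ≡⟨ sumℚ-++ (map f (F x)) _ ⟩
  sumℚ (map f (F x)) + sumℚ (map f (concatMap F xs))  ≡⟨ cong (sumℚ (map f (F x)) +_) (sumℚ-concatMap f F xs) ⟩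
  sumℚ (map (λ x → sumℚ (map f (F x))) (x ∷ xs))      ∎

sumℚ-filterᵇ : ∀ (p : A → Bool) (f : A → ℚ) xs →
  sumℚ (map f (filterᵇ p xs)) ≡ sumℚ (map (λ x → if p x then f x else 0ℚ) xs)
sumℚ-filterᵇ p f []       = refl
sumℚ-filterᵇ p f (x ∷ xs) with p x
... | true  = cong (f x +_) (sumℚ-filterᵇ p f xs)
... | false = trans (sumℚ-filterᵇ p f xs) (sym (ℚP.+-identityˡ _))

prodℚ-filterᵇ : ∀ (p : A → Bool) (f : A → ℚ) xs →
  prodℚ (map f (filterᵇ p xs)) ≡ prodℚ (map (λ x → if p x then f x else 1ℚ) xs)
prodℚ-filterᵇ p f []       = refl
prodℚ-filterᵇ p f (x ∷ xs) with p x
... | true  = cong (f x *_) (prodℚ-filterᵇ p f xs)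
... | false = trans (prodℚ-filterᵇ p f xs) (sym (ℚP.*-identityˡ _))

filterᵇ-++ : ∀ (p : A → Bool) xs ys → filterᵇ p (xs ++ ys) ≡ filterᵇ p xs ++ filterᵇ p ys
filterᵇ-++ p []       ys = refl
filterᵇ-++ p (x ∷ xs) ys with p x
... | true  = cong (x ∷_) (filterᵇ-++ p xs ys)
... | false = filterᵇ-++ p xs ys

filterᵇ-concatMap : ∀ {B : Set} (p : B → Bool) (F : A → List B) xs →
  filterᵇ p (concatMap F xs) ≡ concatMap (filterᵇ p ∘ F) xs
filterᵇ-concatMap p F []       = refl
filterᵇ-concatMap p F (x ∷ xs) =
  trans (filterᵇ-++ p (F x) (concatMap F xs)) (cong (filterᵇ p (F x) ++_) (filterᵇ-concatMap p F xs))

filterᵇ-map : ∀ {B : Set} (p : B → Bool) (f : A → B) xs → filterᵇ p (map f xs) ≡ map f (filterᵇ (p ∘ f) xs)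
filterᵇ-map p f []       = refl
filterᵇ-map p f (x ∷ xs) with p (f x)
... | true  = cong (f x ∷_) (filterᵇ-map p f xs)
... | false = filterᵇ-map p f xs

filterᵇ-cong : ∀ {p q : A → Bool} xs → (∀ {x} → x ∈ xs → p x ≡ q x) → filterᵇ p xs ≡ filterᵇ q xs
filterᵇ-cong []                 p≡q = refl
filterᵇ-cong {p = p} {q} (x ∷ xs) p≡q with p x | q x | p≡q (here refl)
... | true  | true  | refl = cong (x ∷_) (filterᵇ-cong xs (p≡q ∘ there))
... | false | false | refl = filterᵇ-cong xs (p≡q ∘ there)

filterᵇ-comm : ∀ (p q : A → Bool) xs → filterᵇ p (filterᵇ q xs) ≡ filterᵇ q (filterᵇ p xs)
filterᵇ-comm p q []       = refl
filterᵇ-comm p q (x ∷ xs) with p x in px | q x in qx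
... | true  | true  rewrite px | qx = cong (x ∷_) (filterᵇ-comm p q xs)
... | true  | false rewrite qx      = filterᵇ-comm p q xs
... | false | true  rewrite px      = filterᵇ-comm p q xs
... | false | false                 = filterᵇ-comm p q xs

filterᵇ-accept : ∀ (p : A → Bool) {x} xs → p x ≡ true → filterᵇ p (x ∷ xs) ≡ x ∷ filterᵇ p xs
filterᵇ-accept p xs px rewrite px = refl

filterᵇ-all : ∀ (p : A → Bool) xs → (∀ {x} → x ∈ xs → p x ≡ true) → filterᵇ p xs ≡ xs
filterᵇ-all p []       _     = refl
filterᵇ-all p (x ∷ xs) p-all with p x | p-all (here refl)
... | true | refl = cong (x ∷_) (filterᵇ-all p xs (p-all ∘ there))

filterᵇ-none : ∀ (p : A → Bool) xs → (∀ {x} → x ∈ xs → p x ≡ false) → filterᵇ p xs ≡ []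
filterᵇ-none p []       _      = refl
filterᵇ-none p (x ∷ xs) p-none with p x | p-none (here refl)
... | false | refl = filterᵇ-none p xs (p-none ∘ there)

∈-filterᵇ⁻ : ∀ (p : A → Bool) {x} xs → x ∈ filterᵇ p xs → x ∈ xs × p x ≡ true
∈-filterᵇ⁻ p (y ∷ xs) x∈ with p y in py
∈-filterᵇ⁻ p (y ∷ xs) (here refl) | true = here refl , py
∈-filterᵇ⁻ p (y ∷ xs) (there x∈)  | true = map₁ there (∈-filterᵇ⁻ p xs x∈)
∈-filterᵇ⁻ p (y ∷ xs) x∈          | false = map₁ there (∈-filterᵇ⁻ p xs x∈)

∈-filterᵇ⁺ : ∀ (p : A → Bool) {x} xs → x ∈ xs → p x ≡ true → x ∈ filterᵇ p xs
∈-filterᵇ⁺ p (y ∷ xs) (here refl) px rewrite px = here refl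
∈-filterᵇ⁺ p (y ∷ xs) (there x∈)  px with p y
... | true  = there (∈-filterᵇ⁺ p xs x∈ px)
... | false = ∈-filterᵇ⁺ p xs x∈ px

length-filterᵇ-≤ : ∀ (p : A → Bool) xs → length (filterᵇ p xs) ≤ length xs
length-filterᵇ-≤ p []       = z≤n
length-filterᵇ-≤ p (x ∷ xs) with p x
... | true  = s≤s (length-filterᵇ-≤ p xs)
... | false = ℕP.m≤n⇒m≤1+n (length-filterᵇ-≤ p xs)

length-filterᵇ-< : ∀ (p : A → Bool) {x} xs → x ∈ xs → p x ≡ false → length (filterᵇ p xs) < length xs
length-filterᵇ-< p (y ∷ xs) (here refl) px rewrite px = s≤s (length-filterᵇ-≤ p xs)
length-filterᵇ-< p (y ∷ xs) (there x∈)  px with p y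
... | true  = s≤s (length-filterᵇ-< p xs x∈ px)
... | false = ℕP.m≤n⇒m≤1+n (length-filterᵇ-< p xs x∈ px)

length-filterᵇ-++ : ∀ {A : Set} (p : A → Bool) xs ys →
  length (filterᵇ p (xs ++ ys)) ≡ length (filterᵇ p xs) ℕ.+ length (filterᵇ p ys)
length-filterᵇ-++ p xs ys = trans (cong length (filterᵇ-++ p xs ys)) (length-++ (filterᵇ p xs))

module _ {A B : Set} (p q : B → Bool) (F : A → List B)
         (≤-everywhere : ∀ x → length (filterᵇ p (F x)) ≤ length (filterᵇ q (F x))) where

  length-filterᵇ-concatMap-≤ : ∀ xs → length (filterᵇ p (concatMap F xs)) ≤ length (filterᵇ q (concatMap F xs))
  length-filterᵇ-concatMap-≤ []       = z≤n
  length-filterᵇ-concatMap-≤ (x ∷ xs)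
    rewrite length-filterᵇ-++ p (F x) (concatMap F xs) | length-filterᵇ-++ q (F x) (concatMap F xs) =
    ℕP.+-mono-≤ (≤-everywhere x) (length-filterᵇ-concatMap-≤ xs)

  length-filterᵇ-concatMap-< : ∀ {z} xs → z ∈ xs → length (filterᵇ p (F z)) < length (filterᵇ q (F z)) →
    length (filterᵇ p (concatMap F xs)) < length (filterᵇ q (concatMap F xs))
  length-filterᵇ-concatMap-< (x ∷ xs) z∈ <-at-z
    rewrite length-filterᵇ-++ p (F x) (concatMap F xs) | length-filterᵇ-++ q (F x) (concatMap F xs)
    with z∈
  ... | here refl  = ℕP.+-mono-<-≤ <-at-z (length-filterᵇ-concatMap-≤ xs)
  ... | there z∈xs = ℕP.+-mono-≤-< (≤-everywhere x) (length-filterᵇ-concatMap-< xs z∈xs <-at-z)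

all-universal : ∀ {A : Set} (p : A → Bool) (F : List A → Bool) → F [] ≡ true →
  (∀ x xs → F (x ∷ xs) ≡ p x ∧ F xs) → ∀ xs → F xs ≡ all p xs
all-universal p F base step xs =
  trans (foldr-universal F (λ x → p x ∧_) true base step xs) (sym (foldr-map _∧_ p true xs))

all-cong : ∀ {A : Set} {p q : A → Bool} xs → (∀ {x} → x ∈ xs → p x ≡ q x) → all p xs ≡ all q xs
all-cong xs p≡q = cong and (map-cong-local (All.tabulate p≡q))

all-filterᵇ : ∀ {A : Set} (p q : A → Bool) xs → (∀ {x} → x ∈ xs → q x ≡ false → p x ≡ true) →
  all p xs ≡ all p (filterᵇ q xs)
all-filterᵇ p q []       _       = refl
all-filterᵇ p q (x ∷ xs) dropped with q x in qx
... | true  = cong (p x ∧_) (all-filterᵇ p q xs (dropped ∘ there))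
... | false rewrite dropped (here refl) qx = all-filterᵇ p q xs (dropped ∘ there)

all-false : ∀ {A : Set} (p : A → Bool) {x} xs → x ∈ xs → p x ≡ false → all p xs ≡ false
all-false p (y ∷ xs) (here refl) px rewrite px = refl
all-false p (y ∷ xs) (there x∈)  px rewrite all-false p xs x∈ px = ∧-zeroʳ (p y)

InjectiveOn : ∀ {B : Set} → (A → B) → List A → Set
InjectiveOn f xs = ∀ {a b} → a ∈ xs → b ∈ xs → f a ≡ f b → a ≡ b

InjectiveOn-⊆ : ∀ {B : Set} {f : A → B} {xs ys} → (∀ {a} → a ∈ xs → a ∈ ys) → InjectiveOn f ys → InjectiveOn f xs
InjectiveOn-⊆ xs⊆ys f-inj a∈ b∈ = f-inj (xs⊆ys a∈) (xs⊆ys b∈)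

Unique-head : ∀ {x : A} {xs} → Unique (x ∷ xs) → x ∉ xs
Unique-head (x≢xs ∷ _) = All.All¬⇒¬Any x≢xs

Unique-filterᵇ : ∀ (p : A → Bool) {xs} → Unique xs → Unique (filterᵇ p xs)
Unique-filterᵇ p []                    = []
Unique-filterᵇ p {x ∷ xs} (x≢xs ∷ xs!) with p x
... | true  = All.tabulate (All.lookup x≢xs ∘ proj₁ ∘ ∈-filterᵇ⁻ p xs) ∷ Unique-filterᵇ p xs!
... | false = Unique-filterᵇ p xs!

Unique-map-on : ∀ {B : Set} (f : A → B) {xs} → InjectiveOn f xs → Unique xs → Unique (map f xs)
Unique-map-on f inj []                    = []
Unique-map-on f {x ∷ xs} inj (x≢xs ∷ xs!) =
  All.map⁺ (All.tabulate (λ y∈ fx≡fy → All.lookup x≢xs y∈ (inj (here refl) (there y∈) fx≡fy)))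
  ∷ Unique-map-on f (λ a∈ b∈ → inj (there a∈) (there b∈)) xs!

Unique-length≤1 : ∀ {A : Set} {xs : List A} → Unique xs → (∀ {a b} → a ∈ xs → b ∈ xs → a ≡ b) → length xs ≤ 1
Unique-length≤1 {xs = []}         _                _      = z≤n
Unique-length≤1 {xs = _ ∷ []}     _                _      = s≤s z≤n
Unique-length≤1 {xs = _ ∷ _ ∷ _} ((x≢y ∷ _) ∷ _) all-eq = ⊥-elim (x≢y (all-eq (here refl) (there (here refl))))

-- Permutations sorted by their last entry

_≢ᵇ_ : Box → Box → Bool
b ≢ᵇ c = not (does (b ≟B c))

≢ᵇ-refl : ∀ c → c ≢ᵇ c ≡ false
≢ᵇ-refl c = cong not (dec-true (c ≟B c) refl)

≢⇒≢ᵇ : ∀ {b c} → b ≢ c → b ≢ᵇ c ≡ true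
≢⇒≢ᵇ {b} {c} b≢c = cong not (dec-false (b ≟B c) b≢c)

≢ᵇ≡false⇒≡ : ∀ {b c} → b ≢ᵇ c ≡ false → b ≡ c
≢ᵇ≡false⇒≡ {b} {c} eq with b ≟B c
... | yes b≡c = b≡c

selects : List A → List (A × List A)
selects []       = []
selects (x ∷ xs) = (x , xs) ∷ map (map₂ (x ∷_)) (selects xs)

sumℚ-selects-proj₁ : ∀ (f : A → ℚ) xs → sumℚ (map (f ∘ proj₁) (selects xs)) ≡ sumℚ (map f xs)
sumℚ-selects-proj₁ f []       = refl
sumℚ-selects-proj₁ f (x ∷ xs) =
  cong (f x +_) (trans (cong sumℚ (sym (map-∘ (selects xs)))) (sumℚ-selects-proj₁ f xs))

∈-selects : ∀ {p : A × List A} xs → p ∈ selects xs → proj₁ p ∈ xs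
∈-selects (x ∷ xs) (here refl) = here refl
∈-selects (x ∷ xs) (there p∈)  with ∈-map⁻ (map₂ (x ∷_)) p∈
... | q , q∈ , refl = there (∈-selects xs q∈)

selects-rest : ∀ {p : Box × List Box} xs → Unique xs → p ∈ selects xs →
  proj₂ p ≡ filterᵇ (_≢ᵇ proj₁ p) xs
selects-rest (x ∷ xs) xs! (here refl) rewrite ≢ᵇ-refl x =
  sym (filterᵇ-all (_≢ᵇ x) xs (λ {b} b∈ → ≢⇒≢ᵇ (λ b≡x → Unique-head xs! (subst (_∈ xs) b≡x b∈))))
selects-rest (x ∷ xs) x∷xs!@(_ ∷ xs!) (there p∈) with ∈-map⁻ (map₂ (x ∷_)) p∈
... | (c , r) , q∈ , refl =
  trans (cong (x ∷_) (selects-rest xs xs! q∈))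
        (sym (filterᵇ-accept (_≢ᵇ c) xs
          (≢⇒≢ᵇ (λ x≡c → Unique-head x∷xs! (subst (_∈ xs) (sym x≡c) (∈-selects xs q∈))))))

sumℚ-selects : ∀ (F : Box → List Box → ℚ) xs → Unique xs →
  sumℚ (map (λ (c , r) → F c r) (selects xs)) ≡ sumℚ (map (λ c → F c (filterᵇ (_≢ᵇ c) xs)) xs)
sumℚ-selects F xs xs! = trans
  (sumℚ-cong (selects xs) (λ {(c , r)} p∈ → cong (F c) (selects-rest xs xs! p∈)))
  (sumℚ-selects-proj₁ (λ c → F c (filterᵇ (_≢ᵇ c) xs)) xs)

∈-inserts-↭ : ∀ (x : A) ys {zs} → zs ∈ inserts x ys → zs ↭ x ∷ ys
∈-inserts-↭ x []       (here refl) = ↭-refl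
∈-inserts-↭ x (y ∷ ys) (here refl) = ↭-refl
∈-inserts-↭ x (y ∷ ys) (there zs∈) with ∈-map⁻ (y ∷_) zs∈
... | vs , vs∈ , refl = ↭-trans (↭-prep y (∈-inserts-↭ x ys vs∈)) (↭-swap y x ↭-refl)

∈-perms-↭ : ∀ (xs : List A) {w} → w ∈ perms xs → w ↭ xs
∈-perms-↭ []       (here refl) = ↭-refl
∈-perms-↭ (x ∷ xs) w∈ with find (∈-concatMap⁻ (inserts x) {xs = perms xs} w∈)
... | v , v∈ , w∈′ = ↭-trans (∈-inserts-↭ x v w∈′) (↭-prep x (∈-perms-↭ xs v∈))

inserts-∷ʳ : ∀ (x c : A) w →
  inserts x (w ++ c ∷ []) ≡ map (_++ c ∷ []) (inserts x w) ++ (w ++ c ∷ x ∷ []) ∷ []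
inserts-∷ʳ x c []      = refl
inserts-∷ʳ x c (y ∷ w) = cong ((x ∷ y ∷ w ++ c ∷ []) ∷_) (begin
  map (y ∷_) (inserts x (w ++ c ∷ []))
    ≡⟨ cong (map (y ∷_)) (inserts-∷ʳ x c w) ⟩
  map (y ∷_) (map (_++ c ∷ []) (inserts x w) ++ (w ++ c ∷ x ∷ []) ∷ [])
    ≡⟨ map-++ (y ∷_) (map (_++ c ∷ []) (inserts x w)) _ ⟩
  map (y ∷_) (map (_++ c ∷ []) (inserts x w)) ++ (y ∷ w ++ c ∷ x ∷ []) ∷ []
    ≡⟨ cong (_++ (y ∷ w ++ c ∷ x ∷ []) ∷ []) (trans (sym (map-∘ (inserts x w))) (map-∘ (inserts x w))) ⟩
  map (_++ c ∷ []) (map (y ∷_) (inserts x w)) ++ (y ∷ w ++ c ∷ x ∷ []) ∷ [] ∎)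

sumPerms : (List A → ℚ) → List A → ℚ
sumPerms G xs = sumℚ (map G (perms xs))

sumByLast : (List A → ℚ) → List A → ℚ
sumByLast G xs = sumℚ (map (λ (c , r) → sumPerms (λ w → G (w ++ c ∷ [])) r) (selects xs))

sumℚ-inserts-∷ʳ : ∀ (G : List A → ℚ) x c w →
  sumℚ (map G (inserts x (w ++ c ∷ [])))
  ≡ sumℚ (map (λ v → G (v ++ c ∷ [])) (inserts x w)) + G ((w ++ c ∷ []) ++ x ∷ [])
sumℚ-inserts-∷ʳ G x c w = begin
  sumℚ (map G (inserts x (w ++ c ∷ [])))
    ≡⟨ cong (sumℚ ∘ map G) (inserts-∷ʳ x c w) ⟩
  sumℚ (map G (map (_++ c ∷ []) (inserts x w) ++ (w ++ c ∷ x ∷ []) ∷ []))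
    ≡⟨ cong sumℚ (map-++ G (map (_++ c ∷ []) (inserts x w)) _) ⟩
  sumℚ (map G (map (_++ c ∷ []) (inserts x w)) ++ G (w ++ c ∷ x ∷ []) ∷ [])
    ≡⟨ sumℚ-++ (map G (map (_++ c ∷ []) (inserts x w))) _ ⟩
  sumℚ (map G (map (_++ c ∷ []) (inserts x w))) + (G (w ++ c ∷ x ∷ []) + 0ℚ)
    ≡⟨ cong₂ _+_ (cong sumℚ (sym (map-∘ (inserts x w))))
                 (trans (ℚP.+-identityʳ _) (cong G (sym (++-assoc w (c ∷ []) (x ∷ []))))) ⟩
  sumℚ (map (λ v → G (v ++ c ∷ [])) (inserts x w)) + G ((w ++ c ∷ []) ++ x ∷ []) ∎

-- Inserting x into the permutations of the remaining elements r either puts x last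
-- (the second sum) or keeps the last entry c (the first sum).
sumByLast-inserts : ∀ (G : List A → ℚ) x (S : List (A × List A)) →
  sumℚ (map (λ (c , r) → sumPerms (λ w → sumℚ (map G (inserts x (w ++ c ∷ [])))) r) S)
  ≡ sumℚ (map (λ (c , r) → sumPerms (λ w → G (w ++ c ∷ [])) (x ∷ r)) S)
    + sumℚ (map (λ (c , r) → sumPerms (λ w → G ((w ++ c ∷ []) ++ x ∷ [])) r) S)
sumByLast-inserts G x []            = refl
sumByLast-inserts G x ((c , r) ∷ S) = begin
  sumPerms (λ w → sumℚ (map G (inserts x (w ++ c ∷ [])))) r + _
    ≡⟨ cong₂ _+_ first (sumByLast-inserts G x S) ⟩
  (P + Q) + (ΣP + ΣQ)
    ≡⟨ solve 4 (λ p q p′ q′ → (p :+ q) :+ (p′ :+ q′) := (p :+ p′) :+ (q :+ q′)) refl P Q ΣP ΣQ ⟩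
  (P + ΣP) + (Q + ΣQ) ∎
  where
  P = sumPerms (λ w → G (w ++ c ∷ [])) (x ∷ r)
  Q = sumPerms (λ w → G ((w ++ c ∷ []) ++ x ∷ [])) r
  ΣP = sumℚ (map (λ (c , r) → sumPerms (λ w → G (w ++ c ∷ [])) (x ∷ r)) S)
  ΣQ = sumℚ (map (λ (c , r) → sumPerms (λ w → G ((w ++ c ∷ []) ++ x ∷ [])) r) S)
  ins : List _ → ℚ
  ins w = sumℚ (map (λ v → G (v ++ c ∷ [])) (inserts x w))
  first : sumPerms (λ w → sumℚ (map G (inserts x (w ++ c ∷ [])))) r ≡ P + Q
  first = begin
    sumPerms (λ w → sumℚ (map G (inserts x (w ++ c ∷ [])))) r
      ≡⟨ cong sumℚ (map-cong (sumℚ-inserts-∷ʳ G x c) (perms r)) ⟩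
    sumPerms (λ w → ins w + G ((w ++ c ∷ []) ++ x ∷ [])) r
      ≡⟨ sumℚ-+ ins (λ w → G ((w ++ c ∷ []) ++ x ∷ [])) (perms r) ⟩
    sumPerms ins r + Q
      ≡⟨ cong (_+ Q) (sym (sumℚ-concatMap (λ w → G (w ++ c ∷ [])) (inserts x) (perms r))) ⟩
    P + Q ∎

sumPerms-∷ : ∀ (x : A) xs G → sumPerms G (x ∷ xs) ≡ sumByLast G (x ∷ xs)
sumPerms-∷ x []       G = solve 1 (λ a → a :+ con 0ℚ := a :+ con 0ℚ :+ con 0ℚ) refl (G (x ∷ []))
sumPerms-∷ x (y ∷ ys) G = begin
  sumℚ (map G (concatMap (inserts x) (perms (y ∷ ys))))  ≡⟨ sumℚ-concatMap G (inserts x) (perms (y ∷ ys)) ⟩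
  sumPerms Gx (y ∷ ys)                                   ≡⟨ sumPerms-∷ y ys Gx ⟩
  sumByLast Gx (y ∷ ys)                                  ≡⟨ sumByLast-inserts G x (selects (y ∷ ys)) ⟩
  Inner + Outer                                          ≡⟨ ℚP.+-comm Inner Outer ⟩
  Outer + Inner                                          ≡⟨ cong (_+ Inner) (sumPerms-∷ y ys (λ w → G (w ++ x ∷ []))) ⟨
  sumPerms (λ w → G (w ++ x ∷ [])) (y ∷ ys) + Inner      ≡⟨ cong (sumPerms (λ w → G (w ++ x ∷ [])) (y ∷ ys) +_)
                                                              (cong sumℚ (map-∘ {g = byLast} {f = map₂ (x ∷_)} (selects (y ∷ ys)))) ⟩
  sumByLast G (x ∷ y ∷ ys)                               ∎
  where
  Gx : List _ → ℚ
  Gx v = sumℚ (map G (inserts x v))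
  byLast : _ × List _ → ℚ
  byLast (c , r) = sumPerms (λ w → G (w ++ c ∷ [])) r
  Inner Outer : ℚ
  Inner = sumℚ (map (λ (c , r) → sumPerms (λ w → G (w ++ c ∷ [])) (x ∷ r)) (selects (y ∷ ys)))
  Outer = sumByLast (λ w → G (w ++ x ∷ [])) (y ∷ ys)

sumPerms-byLast : ∀ {x} xs → x ∈ xs → Unique xs → (G : List Box → ℚ) →
  sumPerms G xs ≡ sumℚ (map (λ c → sumPerms (λ w → G (w ++ c ∷ [])) (filterᵇ (_≢ᵇ c) xs)) xs)
sumPerms-byLast (x ∷ xs) _ xs! G =
  trans (sumPerms-∷ x xs G) (sumℚ-selects (λ c → sumPerms (λ w → G (w ++ c ∷ []))) (x ∷ xs) xs!)

-- Partial fractions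

module Lagrange {A : Set} (y : A → ℚ) where

  term : ℚ → List A → A × List A → ℚ
  term t ss (d , es) =
    prodℚ (map (λ s → y d - y s) ss) * inv (prodℚ (map (λ e → y d - y e) es)) * inv (t - y d)

  fraction : ℚ → List A → List A → ℚ
  fraction t ss ds = prodℚ (map (λ s → t - y s) ss) * inv (prodℚ (map (λ d → t - y d) ds))

  termSum : ℚ → List A → List A → ℚ
  termSum t ss ds = sumℚ (map (term t ss) (selects ds))

  termSum-∷ : ∀ t ss d₀ ds → termSum t ss (d₀ ∷ ds) ≡
    term t ss (d₀ , ds) + sumℚ (map (λ (d , es) → term t ss (d , d₀ ∷ es)) (selects ds))
  termSum-∷ t ss d₀ ds = cong (term t ss (d₀ , ds) +_) (cong sumℚ (sym (map-∘ (selects ds))))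

  term-∷-node : ∀ {t d d₀} es → y d ≢ y d₀ → t ≢ y d → t ≢ y d₀ →
    term t [] (d , d₀ ∷ es) ≡ inv (t - y d₀) * (term t [] (d , es) - term (y d₀) [] (d , es))
  term-∷-node {t} {d} {d₀} es d≢d₀ t≢d t≢d₀ = begin
    1ℚ * inv ((y d - y d₀) * E) * inv (t - y d)
      ≡⟨ cong (λ z → 1ℚ * z * inv (t - y d)) (inv-* (y d - y d₀) E) ⟩
    1ℚ * (inv (y d - y d₀) * inv E) * inv (t - y d)
      ≡⟨ solve 3 (λ a b c → con 1ℚ :* (a :* b) :* c := b :* (a :* c)) refl (inv (y d - y d₀)) (inv E) (inv (t - y d)) ⟩
    inv E * (inv (y d - y d₀) * inv (t - y d))
      ≡⟨ cong (inv E *_) (partial-fractions d≢d₀ t≢d t≢d₀) ⟩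
    inv E * (inv (t - y d₀) * (inv (t - y d) - inv (y d₀ - y d)))
      ≡⟨ solve 4 (λ e w a b → e :* (w :* (a :- b)) := w :* (con 1ℚ :* e :* a :- con 1ℚ :* e :* b))
           refl (inv E) (inv (t - y d₀)) (inv (t - y d)) (inv (y d₀ - y d)) ⟩
    inv (t - y d₀) * (term t [] (d , es) - term (y d₀) [] (d , es)) ∎
    where
    E = prodℚ (map (λ e → y d - y e) es)

  term-∷-numerator : ∀ {t s d d₀} ss es → y d ≢ y d₀ →
    term t (s ∷ ss) (d , d₀ ∷ es) ≡ term t ss (d , es) + (y d₀ - y s) * term t ss (d , d₀ ∷ es)
  term-∷-numerator {t} {s} {d} {d₀} ss es d≢d₀ = begin
    (y d - y s) * Π * inv ((y d - y d₀) * E) * V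
      ≡⟨ cong (λ z → (y d - y s) * Π * z * V) (inv-* (y d - y d₀) E) ⟩
    (y d - y s) * Π * (u * inv E) * V
      ≡⟨ solve 7 (λ d s d₀ p u e v → (d :- s) :* p :* (u :* e) :* v
                   := ((d :- d₀) :* u) :* (p :* e :* v) :+ (d₀ :- s) :* (p :* (u :* e) :* v))
           refl (y d) (y s) (y d₀) Π u (inv E) V ⟩
    ((y d - y d₀) * u) * (Π * inv E * V) + (y d₀ - y s) * (Π * (u * inv E) * V)
      ≡⟨ cong₂ (λ a b → a * (Π * inv E * V) + (y d₀ - y s) * (Π * b * V))
           (*-inv (y d - y d₀) (p≢q⇒p-q≢0 d≢d₀)) (sym (inv-* (y d - y d₀) E)) ⟩
    1ℚ * (Π * inv E * V) + (y d₀ - y s) * (Π * inv ((y d - y d₀) * E) * V)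
      ≡⟨ cong (_+ (y d₀ - y s) * (Π * inv ((y d - y d₀) * E) * V)) (ℚP.*-identityˡ (Π * inv E * V)) ⟩
    term t ss (d , es) + (y d₀ - y s) * term t ss (d , d₀ ∷ es) ∎
    where
    Π = prodℚ (map (λ s → y d - y s) ss)
    E = prodℚ (map (λ e → y d - y e) es)
    u = inv (y d - y d₀)
    V = inv (t - y d)

  termSum-∷-node : ∀ {t d₀} ds → (∀ {d} → d ∈ ds → y d ≢ y d₀) → (∀ {d} → d ∈ ds → t ≢ y d) → t ≢ y d₀ →
    termSum t [] ds ≡ fraction t [] ds → termSum (y d₀) [] ds ≡ fraction (y d₀) [] ds →
    termSum t [] (d₀ ∷ ds) ≡ fraction t [] (d₀ ∷ ds)
  termSum-∷-node {t} {d₀} ds d≢d₀ t≢d t≢d₀ IHₜ IH₀ = begin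
    termSum t [] (d₀ ∷ ds)
      ≡⟨ termSum-∷ t [] d₀ ds ⟩
    Q₀ * w + sumℚ (map (λ (d , es) → term t [] (d , d₀ ∷ es)) (selects ds))
      ≡⟨ cong (Q₀ * w +_) (sumℚ-cong (selects ds) (λ {(d , es)} p∈ →
           term-∷-node es (d≢d₀ (∈-selects ds p∈)) (t≢d (∈-selects ds p∈)) t≢d₀)) ⟩
    Q₀ * w + sumℚ (map (λ p → w * (term t [] p - term (y d₀) [] p)) (selects ds))
      ≡⟨ cong (Q₀ * w +_) (*-sumℚ w (λ p → term t [] p - term (y d₀) [] p) (selects ds)) ⟨
    Q₀ * w + w * sumℚ (map (λ p → term t [] p - term (y d₀) [] p) (selects ds))
      ≡⟨ cong (λ z → Q₀ * w + w * z) (trans (sumℚ-+ (term t []) (λ p → - term (y d₀) [] p) (selects ds))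
           (cong (termSum t [] ds +_) (sumℚ-neg (term (y d₀) []) (selects ds)))) ⟩
    Q₀ * w + w * (termSum t [] ds - termSum (y d₀) [] ds)
      ≡⟨ cong₂ (λ a b → Q₀ * w + w * (a - b)) IHₜ IH₀ ⟩
    Q₀ * w + w * (1ℚ * Qₜ - 1ℚ * inv (prodℚ (map (λ d → y d₀ - y d) ds)))
      ≡⟨ solve 3 (λ q₀ w qₜ → con 1ℚ :* q₀ :* w :+ w :* (con 1ℚ :* qₜ :- con 1ℚ :* q₀) := con 1ℚ :* (w :* qₜ))
           refl (inv (prodℚ (map (λ d → y d₀ - y d) ds))) w Qₜ ⟩
    1ℚ * (w * Qₜ)
      ≡⟨ cong (1ℚ *_) (inv-* (t - y d₀) _) ⟨
    fraction t [] (d₀ ∷ ds) ∎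
    where
    w = inv (t - y d₀)
    Q₀ = 1ℚ * inv (prodℚ (map (λ d → y d₀ - y d) ds))
    Qₜ = inv (prodℚ (map (λ d → t - y d) ds))

  termSum-∷-numerator : ∀ {t s d₀} ss ds → (∀ {d} → d ∈ ds → y d ≢ y d₀) → t ≢ y d₀ →
    termSum t ss ds ≡ fraction t ss ds → termSum t ss (d₀ ∷ ds) ≡ fraction t ss (d₀ ∷ ds) →
    termSum t (s ∷ ss) (d₀ ∷ ds) ≡ fraction t (s ∷ ss) (d₀ ∷ ds)
  termSum-∷-numerator {t} {s} {d₀} ss ds d≢d₀ t≢d₀ IH IH₀ = begin
    termSum t (s ∷ ss) (d₀ ∷ ds)
      ≡⟨ termSum-∷ t (s ∷ ss) d₀ ds ⟩
    term t (s ∷ ss) (d₀ , ds) + sumℚ (map (λ (d , es) → term t (s ∷ ss) (d , d₀ ∷ es)) (selects ds))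
      ≡⟨ cong₂ _+_ head-term (sumℚ-cong (selects ds) (λ {(d , es)} p∈ →
           term-∷-numerator {t} {s} {d} {d₀} ss es (d≢d₀ (∈-selects ds p∈)))) ⟩
    c * term t ss (d₀ , ds) + sumℚ (map (λ (d , es) → term t ss (d , es) + c * term t ss (d , d₀ ∷ es)) (selects ds))
      ≡⟨ cong (c * term t ss (d₀ , ds) +_) (sumℚ-+ (term t ss) (λ (d , es) → c * term t ss (d , d₀ ∷ es)) (selects ds)) ⟩
    c * term t ss (d₀ , ds) + (termSum t ss ds + sumℚ (map (λ (d , es) → c * term t ss (d , d₀ ∷ es)) (selects ds)))
      ≡⟨ cong (λ z → c * term t ss (d₀ , ds) + (termSum t ss ds + z))
           (sym (*-sumℚ c (λ (d , es) → term t ss (d , d₀ ∷ es)) (selects ds))) ⟩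
    c * term t ss (d₀ , ds) + (termSum t ss ds + c * Rest)
      ≡⟨ solve 4 (λ c a b r → c :* a :+ (b :+ c :* r) := b :+ c :* (a :+ r)) refl c (term t ss (d₀ , ds)) (termSum t ss ds) Rest ⟩
    termSum t ss ds + c * (term t ss (d₀ , ds) + Rest)
      ≡⟨ cong (λ z → termSum t ss ds + c * z) (termSum-∷ t ss d₀ ds) ⟨
    termSum t ss ds + c * termSum t ss (d₀ ∷ ds)
      ≡⟨ cong₂ (λ a b → a + c * b) IH IH₀ ⟩
    Π * Q + c * (Π * inv ((t - y d₀) * P))
      ≡⟨ cong (λ z → Π * Q + c * (Π * z)) (inv-* (t - y d₀) P) ⟩
    Π * Q + c * (Π * (w * Q))
      ≡⟨ cong (_+ c * (Π * (w * Q))) (ℚP.*-identityˡ (Π * Q)) ⟨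
    1ℚ * (Π * Q) + c * (Π * (w * Q))
      ≡⟨ cong (λ z → z * (Π * Q) + c * (Π * (w * Q))) (*-inv (t - y d₀) (p≢q⇒p-q≢0 t≢d₀)) ⟨
    ((t - y d₀) * w) * (Π * Q) + c * (Π * (w * Q))
      ≡⟨ solve 6 (λ t d₀ s w p q → ((t :- d₀) :* w) :* (p :* q) :+ (d₀ :- s) :* (p :* (w :* q)) := (t :- s) :* p :* (w :* q))
           refl t (y d₀) (y s) w Π Q ⟩
    (t - y s) * Π * (w * Q)
      ≡⟨ cong ((t - y s) * Π *_) (inv-* (t - y d₀) P) ⟨
    fraction t (s ∷ ss) (d₀ ∷ ds) ∎
    where
    c = y d₀ - y s
    w = inv (t - y d₀)
    Π = prodℚ (map (λ s → t - y s) ss)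
    P = prodℚ (map (λ d → t - y d) ds)
    Q = inv P
    Rest = sumℚ (map (λ (d , es) → term t ss (d , d₀ ∷ es)) (selects ds))
    head-term : term t (s ∷ ss) (d₀ , ds) ≡ c * term t ss (d₀ , ds)
    head-term = solve 4 (λ a b e f → a :* b :* e :* f := a :* (b :* e :* f)) refl
      c (prodℚ (map (λ s → y d₀ - y s) ss)) (inv (prodℚ (map (λ e → y d₀ - y e) ds))) (inv (t - y d₀))

  -- The partial-fraction expansion of the proper rational function t ↦ fraction t ss ds.
  termSum≡fraction : ∀ ss ds t → length ss < length ds → Unique (t ∷ map y ds) → termSum t ss ds ≡ fraction t ss ds
  termSum≡fraction [] (d₀ ∷ []) t _ _ = begin
    1ℚ * 1ℚ * inv (t - y d₀) + 0ℚ   ≡⟨ solve 1 (λ a → con 1ℚ :* con 1ℚ :* a :+ con 0ℚ := con 1ℚ :* a)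
                                         refl (inv (t - y d₀)) ⟩
    1ℚ * inv (t - y d₀)             ≡⟨ cong (λ z → 1ℚ * inv z) (ℚP.*-identityʳ (t - y d₀)) ⟨
    1ℚ * inv ((t - y d₀) * 1ℚ)      ∎
  termSum≡fraction [] (d₀ ∷ ds@(_ ∷ _)) t _ ((t≢d₀ ∷ t≢ds) ∷ d₀≢ds ∷ ds!) =
    termSum-∷-node ds (≢-sym ∘ All.lookup (All.map⁻ d₀≢ds)) (All.lookup (All.map⁻ t≢ds)) t≢d₀
      (termSum≡fraction [] ds t (s≤s z≤n) (t≢ds ∷ ds!))
      (termSum≡fraction [] ds (y d₀) (s≤s z≤n) (d₀≢ds ∷ ds!))
  termSum≡fraction (s ∷ ss) (d₀ ∷ ds) t (s≤s ss<ds) t∷d₀∷ds!@((t≢d₀ ∷ t≢ds) ∷ d₀≢ds ∷ ds!) =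
    termSum-∷-numerator ss ds (≢-sym ∘ All.lookup (All.map⁻ d₀≢ds)) t≢d₀
      (termSum≡fraction ss ds t ss<ds (t≢ds ∷ ds!))
      (termSum≡fraction ss (d₀ ∷ ds) t (ℕP.m<n⇒m<1+n ss<ds) t∷d₀∷ds!)

row-≥length : ∀ l {r} → length l ≤ r → row l r ≡ 0
row-≥length []      _                 = refl
row-≥length (_ ∷ l) {suc r} (s≤s l≤r) = row-≥length l l≤r

<⇒≡suc-pred : ∀ {m n} → m < n → n ≡ suc (pred n)
<⇒≡suc-pred {n = suc n} _ = refl

-- does (InSkew? λ′ ν b) reduces to inSkewᵇ λ′ ν b.
InSkew? : ∀ λ′ ν b → Dec (InSkew λ′ ν b)
InSkew? λ′ ν (r , c) = (row ν r ℕ.≤? c) ×-dec (c ℕ.<? row λ′ r)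

InSkew⇒inSkewᵇ : ∀ λ′ ν b → InSkew λ′ ν b → inSkewᵇ λ′ ν b ≡ true
InSkew⇒inSkewᵇ λ′ ν b = dec-true (InSkew? λ′ ν b)

inSkewᵇ⇒InSkew : ∀ λ′ ν b → inSkewᵇ λ′ ν b ≡ true → InSkew λ′ ν b
inSkewᵇ⇒InSkew λ′ ν b eq = invert (subst (Reflects (InSkew λ′ ν b)) eq (proof (InSkew? λ′ ν b)))

¬InSkew⇒inSkewᵇ : ∀ λ′ ν b → ¬ InSkew λ′ ν b → inSkewᵇ λ′ ν b ≡ false
¬InSkew⇒inSkewᵇ λ′ ν b = dec-false (InSkew? λ′ ν b)

inSkewᵇ≡false⇒¬InSkew : ∀ λ′ ν b → inSkewᵇ λ′ ν b ≡ false → ¬ InSkew λ′ ν b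
inSkewᵇ≡false⇒¬InSkew λ′ ν b b∉ b∈ with trans (sym (InSkew⇒inSkewᵇ λ′ ν b b∈)) b∉
... | ()

InSkew⇒row< : ∀ λ′ ν {r c} → InSkew λ′ ν (r , c) → r < length λ′
InSkew⇒row< λ′ ν {r} (_ , c<λ) with r ℕ.<? length λ′
... | yes r<len = r<len
... | no  r≮len = ⊥-elim (ℕP.n≮0 (subst (_ <_) (row-≥length λ′ (ℕP.≮⇒≥ r≮len)) c<λ))

∈-range⁻ : ∀ {c} a b → c ∈ range a b → a ≤ c × c < b
∈-range⁻ a b c∈ with ∈-map⁻ (a ℕ.+_) c∈
... | i , i∈ , refl with a ℕ.≤? b
...   | yes a≤b = ℕP.m≤m+n a i , subst (a ℕ.+ i <_) (ℕP.m+[n∸m]≡n a≤b) (ℕP.+-monoʳ-< a (∈-upTo⁻ i∈))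
...   | no  a≰b = ⊥-elim (ℕP.n≮0 (subst (i <_) (ℕP.m≤n⇒m∸n≡0 (ℕP.<⇒≤ (ℕP.≰⇒> a≰b))) (∈-upTo⁻ i∈)))

∈-range⁺ : ∀ {c} a b → a ≤ c → c < b → c ∈ range a b
∈-range⁺ {c} a b a≤c c<b =
  subst (_∈ range a b) (ℕP.m+[n∸m]≡n a≤c) (∈-map⁺ (a ℕ.+_) (∈-upTo⁺ (ℕP.∸-monoˡ-< c<b a≤c)))

range-∷ʳ : ∀ a b → a ≤ b → range a (suc b) ≡ range a b ++ b ∷ []
range-∷ʳ a b a≤b = begin
  map (a ℕ.+_) (upTo (suc b ∸ a))               ≡⟨ cong (map (a ℕ.+_) ∘ upTo) (ℕP.+-∸-assoc 1 a≤b) ⟩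
  map (a ℕ.+_) (upTo (suc (b ∸ a)))             ≡⟨ cong (map (a ℕ.+_)) (upTo-∷ʳ (b ∸ a)) ⟨
  map (a ℕ.+_) (upTo (b ∸ a) ++ (b ∸ a) ∷ [])   ≡⟨ map-++ (a ℕ.+_) (upTo (b ∸ a)) _ ⟩
  range a b ++ (a ℕ.+ (b ∸ a)) ∷ []             ≡⟨ cong (λ z → range a b ++ z ∷ []) (ℕP.m+[n∸m]≡n a≤b) ⟩
  range a b ++ b ∷ []                           ∎

Unique-range : ∀ a b → Unique (range a b)
Unique-range a b = Unique.map⁺ (ℕP.+-cancelˡ-≡ a _ _) (Unique.upTo⁺ (b ∸ a))

rowBoxes : List ℕ → List ℕ → ℕ → List Box
rowBoxes λ′ ν r = map (r ,_) (range (row ν r) (row λ′ r))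

∈-rowBoxes⁻ : ∀ λ′ ν {r b} → b ∈ rowBoxes λ′ ν r → proj₁ b ≡ r × InSkew λ′ ν b
∈-rowBoxes⁻ λ′ ν {r} b∈ with ∈-map⁻ (r ,_) b∈
... | c , c∈ , refl = refl , ∈-range⁻ (row ν r) (row λ′ r) c∈

∈-rowBoxes⁺ : ∀ λ′ ν {r c} → InSkew λ′ ν (r , c) → (r , c) ∈ rowBoxes λ′ ν r
∈-rowBoxes⁺ λ′ ν {r} (ν≤c , c<λ) = ∈-map⁺ (r ,_) (∈-range⁺ (row ν r) (row λ′ r) ν≤c c<λ)

∈-boxes⁻ : ∀ λ′ ν {b} → b ∈ boxes λ′ ν → InSkew λ′ ν b
∈-boxes⁻ λ′ ν b∈ with find (∈-concatMap⁻ (rowBoxes λ′ ν) {xs = upTo (length λ′)} b∈)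
... | r , _ , b∈row = proj₂ (∈-rowBoxes⁻ λ′ ν {r} b∈row)

∈-boxes⁺ : ∀ λ′ ν b → InSkew λ′ ν b → b ∈ boxes λ′ ν
∈-boxes⁺ λ′ ν (r , c) (ν≤c , c<λ) = ∈-concatMap⁺ (rowBoxes λ′ ν)
  (lose (∈-upTo⁺ (InSkew⇒row< λ′ ν (ν≤c , c<λ))) (∈-map⁺ (r ,_) (∈-range⁺ (row ν r) (row λ′ r) ν≤c c<λ)))

Unique-boxes : ∀ λ′ ν → Unique (boxes λ′ ν)
Unique-boxes λ′ ν = Unique.concat⁺
  (All.map⁺ (All.universal (λ r → Unique.map⁺ (cong proj₂) (Unique-range (row ν r) (row λ′ r))) (upTo (length λ′))))
  (AllPairs.map⁺ (AllPairs.map disjoint (Unique.upTo⁺ (length λ′))))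
  where
  disjoint : ∀ {r r′} → r ≢ r′ → Disjoint (rowBoxes λ′ ν r) (rowBoxes λ′ ν r′)
  disjoint {r} {r′} r≢r′ (b∈r , b∈r′) =
    r≢r′ (trans (sym (proj₁ (∈-rowBoxes⁻ λ′ ν {r} b∈r))) (proj₁ (∈-rowBoxes⁻ λ′ ν {r′} b∈r′)))

right≢ : ∀ b → right b ≢ b
right≢ (r , c) eq = ℕP.1+n≢n (cong proj₂ eq)

below≢ : ∀ b → below b ≢ b
below≢ (r , c) eq = ℕP.1+n≢n (cong proj₁ eq)

right≢below : ∀ b → right b ≢ below b
right≢below (r , c) eq = ℕP.1+n≢n (sym (cong proj₁ eq))

dullᵇ⇒noNeighbours : ∀ λ′ ν b → dullᵇ λ′ ν b ≡ true →
  inSkewᵇ λ′ ν (right b) ≡ false × inSkewᵇ λ′ ν (below b) ≡ false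
dullᵇ⇒noNeighbours λ′ ν b dull with to T-∧ (from T-≡ dull)
... | noRight , noBelow = to T-not-≡ noRight , to T-not-≡ noBelow

dull⇒lastInRow : ∀ λ′ ν {r c} → InSkew λ′ ν (r , c) → dullᵇ λ′ ν (r , c) ≡ true → row λ′ r ≡ suc c
dull⇒lastInRow λ′ ν {r} {c} (ν≤c , c<λ) dull =
  ℕP.≤-antisym (ℕP.≮⇒≥ (λ 1+c<λ → noRight (ℕP.m≤n⇒m≤1+n ν≤c , 1+c<λ))) c<λ
  where
  noRight : ¬ InSkew λ′ ν (r , suc c)
  noRight = inSkewᵇ≡false⇒¬InSkew λ′ ν (r , suc c) (proj₁ (dullᵇ⇒noNeighbours λ′ ν (r , c) dull))

shrinkRow : List ℕ → ℕ → List ℕ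
shrinkRow []       _       = []
shrinkRow (a ∷ as) zero    = pred a ∷ as
shrinkRow (a ∷ as) (suc r) = a ∷ shrinkRow as r

length-shrinkRow : ∀ λ′ r → length (shrinkRow λ′ r) ≡ length λ′
length-shrinkRow []       _       = refl
length-shrinkRow (a ∷ as) zero    = refl
length-shrinkRow (a ∷ as) (suc r) = cong suc (length-shrinkRow as r)

row-shrinkRow-≡ : ∀ λ′ r → row (shrinkRow λ′ r) r ≡ pred (row λ′ r)
row-shrinkRow-≡ []       _       = refl
row-shrinkRow-≡ (a ∷ as) zero    = refl
row-shrinkRow-≡ (a ∷ as) (suc r) = row-shrinkRow-≡ as r

row-shrinkRow-≢ : ∀ λ′ {r r′} → r′ ≢ r → row (shrinkRow λ′ r) r′ ≡ row λ′ r′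
row-shrinkRow-≢ []       _                         = refl
row-shrinkRow-≢ (a ∷ as) {zero}  {zero}  r′≢r      = ⊥-elim (r′≢r refl)
row-shrinkRow-≢ (a ∷ as) {zero}  {suc r′} _        = refl
row-shrinkRow-≢ (a ∷ as) {suc r} {zero}  _         = refl
row-shrinkRow-≢ (a ∷ as) {suc r} {suc r′} r′≢r     = row-shrinkRow-≢ as (r′≢r ∘ cong suc)

row-shrinkRow-≤ : ∀ λ′ r r′ → row (shrinkRow λ′ r) r′ ≤ row λ′ r′
row-shrinkRow-≤ λ′ r r′ with r′ ℕ.≟ r
... | yes refl  = subst (_≤ row λ′ r) (sym (row-shrinkRow-≡ λ′ r)) ℕP.pred[n]≤n
... | no  r′≢r  = ℕP.≤-reflexive (row-shrinkRow-≢ λ′ r′≢r)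

InSkew-shrinkRow⁻ : ∀ λ′ ν r {b} → InSkew (shrinkRow λ′ r) ν b → InSkew λ′ ν b
InSkew-shrinkRow⁻ λ′ ν r {r′ , c′} (ν≤c′ , c′<) = ν≤c′ , ℕP.<-≤-trans c′< (row-shrinkRow-≤ λ′ r r′)

InSkew-shrinkRow : ∀ λ′ ν {r c} → row λ′ r ≡ suc c → ∀ b →
  InSkew (shrinkRow λ′ r) ν b ⇔ (InSkew λ′ ν b × b ≢ (r , c))
InSkew-shrinkRow λ′ ν {r} {c} λr≡1+c b@(r′ , c′) = mk⇔ to′ from′
  where
  row-r : row (shrinkRow λ′ r) r ≡ c
  row-r = trans (row-shrinkRow-≡ λ′ r) (cong pred λr≡1+c)
  to′ : InSkew (shrinkRow λ′ r) ν b → InSkew λ′ ν b × b ≢ (r , c)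
  to′ b∈ = InSkew-shrinkRow⁻ λ′ ν r b∈ , λ { refl → ℕP.<-irrefl (sym row-r) (proj₂ b∈) }
  from′ : InSkew λ′ ν b × b ≢ (r , c) → InSkew (shrinkRow λ′ r) ν b
  from′ ((ν≤c′ , c′<) , b≢rc) with r′ ℕ.≟ r
  ... | no  r′≢r = ν≤c′ , subst (c′ <_) (sym (row-shrinkRow-≢ λ′ r′≢r)) c′<
  ... | yes refl = ν≤c′ , subst (c′ <_) (sym row-r)
                     (ℕP.≤∧≢⇒< (ℕP.≤-pred (subst (c′ <_) λr≡1+c c′<)) (b≢rc ∘ cong (r ,_)))

inSkewᵇ-shrinkRow : ∀ λ′ ν {r c} → row λ′ r ≡ suc c → ∀ b →
  inSkewᵇ (shrinkRow λ′ r) ν b ≡ inSkewᵇ λ′ ν b ∧ (b ≢ᵇ (r , c))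
inSkewᵇ-shrinkRow λ′ ν {r} {c} λr≡1+c b =
  does-⇔ (InSkew-shrinkRow λ′ ν λr≡1+c b) (InSkew? (shrinkRow λ′ r) ν b) (InSkew? λ′ ν b ×-dec ¬? (b ≟B (r , c)))

inSkewᵇ-lastInRow : ∀ λ′ ν {r c} → row λ′ r ≡ suc c → row ν r ≤ c → inSkewᵇ λ′ ν (r , c) ≡ true
inSkewᵇ-lastInRow λ′ ν {r} {c} λr≡1+c νr≤c =
  InSkew⇒inSkewᵇ λ′ ν (r , c) (νr≤c , subst (c <_) (sym λr≡1+c) (ℕP.n<1+n c))

∈-boxes-lastInRow : ∀ λ′ ν {r c} → row λ′ r ≡ suc c → row ν r ≤ c → (r , c) ∈ boxes λ′ ν
∈-boxes-lastInRow λ′ ν {r} {c} λr≡1+c νr≤c =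
  ∈-boxes⁺ λ′ ν (r , c) (νr≤c , subst (c <_) (sym λr≡1+c) (ℕP.n<1+n c))

rowBoxes-shrinkRow : ∀ λ′ ν {r c} → row λ′ r ≡ suc c → row ν r ≤ c →
  ∀ r′ → rowBoxes (shrinkRow λ′ r) ν r′ ≡ filterᵇ (_≢ᵇ (r , c)) (rowBoxes λ′ ν r′)
rowBoxes-shrinkRow λ′ ν {r} {c} λr≡1+c νr≤c r′ with r′ ℕ.≟ r
... | no r′≢r = begin
  map (r′ ,_) (range (row ν r′) (row (shrinkRow λ′ r) r′))
    ≡⟨ cong (map (r′ ,_) ∘ range (row ν r′)) (row-shrinkRow-≢ λ′ r′≢r) ⟩
  rowBoxes λ′ ν r′
    ≡⟨ filterᵇ-all (_≢ᵇ (r , c)) (rowBoxes λ′ ν r′)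
         (λ b∈ → ≢⇒≢ᵇ (r′≢r ∘ trans (sym (proj₁ (∈-rowBoxes⁻ λ′ ν b∈))) ∘ cong proj₁)) ⟨
  filterᵇ (_≢ᵇ (r , c)) (rowBoxes λ′ ν r′) ∎
... | yes refl = begin
  map (r ,_) (range (row ν r) (row (shrinkRow λ′ r) r))
    ≡⟨ cong (map (r ,_) ∘ range (row ν r)) (trans (row-shrinkRow-≡ λ′ r) (cong pred λr≡1+c)) ⟩
  map (r ,_) (range (row ν r) c)
    ≡⟨ filterᵇ-all (_≢ᵇ (r , c)) _ (λ b∈ → ≢⇒≢ᵇ (left-of-c b∈)) ⟨
  filterᵇ (_≢ᵇ (r , c)) (map (r ,_) (range (row ν r) c))
    ≡⟨ ++-identityʳ _ ⟨
  filterᵇ (_≢ᵇ (r , c)) (map (r ,_) (range (row ν r) c)) ++ []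
    ≡⟨ cong (filterᵇ (_≢ᵇ (r , c)) (map (r ,_) (range (row ν r) c)) ++_)
         (filterᵇ-none (_≢ᵇ (r , c)) ((r , c) ∷ []) (λ { (here refl) → ≢ᵇ-refl (r , c) })) ⟨
  filterᵇ (_≢ᵇ (r , c)) (map (r ,_) (range (row ν r) c)) ++ filterᵇ (_≢ᵇ (r , c)) ((r , c) ∷ [])
    ≡⟨ filterᵇ-++ (_≢ᵇ (r , c)) (map (r ,_) (range (row ν r) c)) _ ⟨
  filterᵇ (_≢ᵇ (r , c)) (map (r ,_) (range (row ν r) c) ++ (r , c) ∷ [])
    ≡⟨ cong (filterᵇ (_≢ᵇ (r , c))) (map-++ (r ,_) (range (row ν r) c) (c ∷ [])) ⟨
  filterᵇ (_≢ᵇ (r , c)) (map (r ,_) (range (row ν r) c ++ c ∷ []))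
    ≡⟨ cong (filterᵇ (_≢ᵇ (r , c)) ∘ map (r ,_)) (range-∷ʳ (row ν r) c νr≤c) ⟨
  filterᵇ (_≢ᵇ (r , c)) (map (r ,_) (range (row ν r) (suc c)))
    ≡⟨ cong (filterᵇ (_≢ᵇ (r , c)) ∘ map (r ,_) ∘ range (row ν r)) λr≡1+c ⟨
  filterᵇ (_≢ᵇ (r , c)) (rowBoxes λ′ ν r) ∎
  where
  left-of-c : ∀ {b} → b ∈ map (r ,_) (range (row ν r) c) → b ≢ (r , c)
  left-of-c b∈ with ∈-map⁻ (r ,_) b∈
  ... | c′ , c′∈ , refl = ℕP.<⇒≢ (proj₂ (∈-range⁻ (row ν r) c c′∈)) ∘ cong proj₂

boxes-shrinkRow : ∀ λ′ ν {r c} → row λ′ r ≡ suc c → row ν r ≤ c →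
  boxes (shrinkRow λ′ r) ν ≡ filterᵇ (_≢ᵇ (r , c)) (boxes λ′ ν)
boxes-shrinkRow λ′ ν {r} {c} λr≡1+c νr≤c = begin
  concatMap (rowBoxes (shrinkRow λ′ r) ν) (upTo (length (shrinkRow λ′ r)))
    ≡⟨ cong (concatMap (rowBoxes (shrinkRow λ′ r) ν) ∘ upTo) (length-shrinkRow λ′ r) ⟩
  concatMap (rowBoxes (shrinkRow λ′ r) ν) (upTo (length λ′))
    ≡⟨ concatMap-cong (rowBoxes-shrinkRow λ′ ν λr≡1+c νr≤c) (upTo (length λ′)) ⟩
  concatMap (filterᵇ (_≢ᵇ (r , c)) ∘ rowBoxes λ′ ν) (upTo (length λ′))
    ≡⟨ filterᵇ-concatMap (_≢ᵇ (r , c)) (rowBoxes λ′ ν) (upTo (length λ′)) ⟨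
  filterᵇ (_≢ᵇ (r , c)) (boxes λ′ ν) ∎

length-boxes-shrinkRow : ∀ λ′ ν {r c} → row λ′ r ≡ suc c → row ν r ≤ c →
  length (boxes (shrinkRow λ′ r) ν) < length (boxes λ′ ν)
length-boxes-shrinkRow λ′ ν {r} {c} λr≡1+c νr≤c =
  subst (λ B → length B < length (boxes λ′ ν)) (sym (boxes-shrinkRow λ′ ν λr≡1+c νr≤c))
    (length-filterᵇ-< (_≢ᵇ (r , c)) (boxes λ′ ν) (∈-boxes-lastInRow λ′ ν λr≡1+c νr≤c) (≢ᵇ-refl (r , c)))

boxes-shrinkRow-⊆ : ∀ λ′ ν r {b} → b ∈ boxes (shrinkRow λ′ r) ν → b ∈ boxes λ′ ν
boxes-shrinkRow-⊆ λ′ ν r {b} b∈ = ∈-boxes⁺ λ′ ν b (InSkew-shrinkRow⁻ λ′ ν r (∈-boxes⁻ (shrinkRow λ′ r) ν b∈))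

BrokenBorderStrip-shrinkRow : ∀ λ′ ν r → BrokenBorderStrip λ′ ν → BrokenBorderStrip (shrinkRow λ′ r) ν
BrokenBorderStrip-shrinkRow λ′ ν r bbs r′ c′ (b₁ , b₂ , b₃ , b₄) =
  bbs r′ c′ (shrink b₁ , shrink b₂ , shrink b₃ , shrink b₄)
  where
  shrink : ∀ {b} → InSkew (shrinkRow λ′ r) ν b → InSkew λ′ ν b
  shrink = InSkew-shrinkRow⁻ λ′ ν r

InjectiveOn-shrinkRow : ∀ λ′ ν {r c} → row λ′ r ≡ suc c → row ν r ≤ c →
  ∀ (y : Box → ℚ) → InjectiveOn y (boxes λ′ ν) →
  ∀ {b} → b ∈ boxes (shrinkRow λ′ r) ν → y (r , c) ≢ y b
InjectiveOn-shrinkRow λ′ ν {r} {c} λr≡1+c νr≤c y y-inj {b} b∈ ym≡yb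
  with ∈-filterᵇ⁻ (_≢ᵇ (r , c)) (boxes λ′ ν) (subst (b ∈_) (boxes-shrinkRow λ′ ν λr≡1+c νr≤c) b∈)
... | b∈B , b≢ᵇm
  with trans (sym b≢ᵇm)
         (trans (cong (_≢ᵇ (r , c)) (sym (y-inj (∈-boxes-lastInRow λ′ ν λr≡1+c νr≤c) b∈B ym≡yb))) (≢ᵇ-refl (r , c)))
...   | ()

-- Standard tableaux sorted by the box of their largest entry

pos-∈ : ∀ {b} w → b ∈ w → ∃ λ k → pos w b ≡ suc k × k < length w
pos-∈ {b} (a ∷ as) b∈ with a ≟B b
... | yes _ = 0 , refl , s≤s z≤n
... | no a≢b with b∈
...   | here b≡a = ⊥-elim (a≢b (sym b≡a))
...   | there b∈as with pos as b | pos-∈ as b∈as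
...     | .(suc k) | k , refl , k<len = suc k , refl , s≤s k<len

pos-++ˡ : ∀ {b} w ys → b ∈ w → pos (w ++ ys) b ≡ pos w b
pos-++ˡ {b} (a ∷ as) ys b∈ with a ≟B b
... | yes _ = refl
... | no a≢b with b∈
...   | here b≡a = ⊥-elim (a≢b (sym b≡a))
...   | there b∈as rewrite pos-++ˡ as ys b∈as = refl

pos-∷ʳ : ∀ {b} w → b ∉ w → pos (w ++ b ∷ []) b ≡ suc (length w)
pos-∷ʳ {b} [] _ with b ≟B b
... | yes _   = refl
... | no b≢b  = ⊥-elim (b≢b refl)
pos-∷ʳ {b} (a ∷ as) b∉ with a ≟B b
... | yes a≡b = ⊥-elim (b∉ (here (sym a≡b)))
... | no _ rewrite pos-∷ʳ as (b∉ ∘ there) = refl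

pos-∷-≡ : ∀ c cs → pos (c ∷ cs) c ≡ 1
pos-∷-≡ c cs with c ≟B c
... | yes _   = refl
... | no c≢c  = ⊥-elim (c≢c refl)

pos-∷-≢ : ∀ {c b} cs → c ≢ b → b ∈ cs → pos (c ∷ cs) b ≡ suc (pos cs b)
pos-∷-≢ {c} {b} cs c≢b b∈ with c ≟B b
... | yes c≡b = ⊥-elim (c≢b c≡b)
... | no _ with pos cs b | pos-∈ cs b∈
...   | .(suc k) | k , refl , _ = refl

pos-injective : ∀ w {a b} → a ∈ w → b ∈ w → pos w a ≡ pos w b → a ≡ b
pos-injective (c ∷ cs) {a} {b} a∈ b∈ eq = by-cases (c ≟B a) (c ≟B b)
  where
  ∈-tail : ∀ {z} → c ≢ z → z ∈ c ∷ cs → z ∈ cs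
  ∈-tail c≢z (here z≡c) = ⊥-elim (c≢z (sym z≡c))
  ∈-tail c≢z (there z∈) = z∈
  pos≢1 : ∀ {z} → c ≢ z → z ∈ c ∷ cs → pos (c ∷ cs) z ≢ 1
  pos≢1 c≢z z∈ pos≡1 with pos-∈ cs (∈-tail c≢z z∈)
  ... | k , pos≡1+k , _ =
    ℕP.0≢1+n (ℕP.suc-injective (trans (sym pos≡1) (trans (pos-∷-≢ cs c≢z (∈-tail c≢z z∈)) (cong suc pos≡1+k))))
  by-cases : Dec (c ≡ a) → Dec (c ≡ b) → a ≡ b
  by-cases (yes c≡a)  (yes c≡b)  = trans (sym c≡a) c≡b
  by-cases (yes refl) (no c≢b)   = ⊥-elim (pos≢1 c≢b b∈ (trans (sym eq) (pos-∷-≡ c cs)))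
  by-cases (no c≢a)   (yes refl) = ⊥-elim (pos≢1 c≢a a∈ (trans eq (pos-∷-≡ c cs)))
  by-cases (no c≢a)   (no c≢b)   = pos-injective cs (∈-tail c≢a a∈) (∈-tail c≢b b∈)
    (ℕP.suc-injective (trans (sym (pos-∷-≢ cs c≢a (∈-tail c≢a a∈))) (trans eq (pos-∷-≢ cs c≢b (∈-tail c≢b b∈)))))

precedesᵇ : List ℕ → List ℕ → List Box → Box → Box → Bool
precedesᵇ μ ν w b x = not (inSkewᵇ μ ν x) ∨ (pos w b <ᵇ pos w x)

standardAtᵇ : List ℕ → List ℕ → List Box → Box → Bool
standardAtᵇ μ ν w b = precedesᵇ μ ν w b (right b) ∧ precedesᵇ μ ν w b (below b)

-- isStandardᵇ folds an anonymous where-function over boxes μ ν; all-universal identifies it with all.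
isStandardᵇ-all : ∀ μ ν w → isStandardᵇ μ ν w ≡ all (standardAtᵇ μ ν w) (boxes μ ν)
isStandardᵇ-all μ ν w with all-universal (standardAtᵇ μ ν w) _ refl (λ _ _ → refl) | boxes μ ν
... | all-standard | bs = all-standard bs

precedesᵇ-∷ʳ : ∀ λ′ ν {r c} → row λ′ r ≡ suc c → ∀ {w} → (r , c) ∉ w →
  (∀ {b} → b ∈ boxes (shrinkRow λ′ r) ν → b ∈ w) → ∀ {b} → b ∈ w → ∀ x →
  precedesᵇ λ′ ν (w ++ (r , c) ∷ []) b x ≡ precedesᵇ (shrinkRow λ′ r) ν w b x
precedesᵇ-∷ʳ λ′ ν {r} {c} λr≡1+c {w} m∉w ⊆w {b} b∈ x
  rewrite inSkewᵇ-shrinkRow λ′ ν λr≡1+c x | pos-++ˡ w ((r , c) ∷ []) b∈ with x ≟B (r , c)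
... | yes refl rewrite pos-∷ʳ w m∉w with inSkewᵇ λ′ ν (r , c) | pos w b | pos-∈ w b∈
...   | true  | .(suc k) | k , refl , k<len = to T-≡ (ℕP.<⇒<ᵇ (s≤s k<len))
...   | false | _        | _                = refl
precedesᵇ-∷ʳ λ′ ν {r} {c} λr≡1+c {w} m∉w ⊆w {b} b∈ x | no x≢m
  rewrite ∧-identityʳ (inSkewᵇ λ′ ν x) with inSkewᵇ λ′ ν x in x∈λ
... | false = refl
... | true  = cong (pos w b <ᵇ_) (pos-++ˡ w ((r , c) ∷ []) (⊆w (∈-boxes⁺ (shrinkRow λ′ r) ν x
                (from (InSkew-shrinkRow λ′ ν λr≡1+c x) (inSkewᵇ⇒InSkew λ′ ν x x∈λ , x≢m)))))

isStandardᵇ-∷ʳ-dull : ∀ λ′ ν {r c} → row λ′ r ≡ suc c → row ν r ≤ c → dullᵇ λ′ ν (r , c) ≡ true →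
  ∀ {w} → w ↭ boxes (shrinkRow λ′ r) ν →
  isStandardᵇ λ′ ν (w ++ (r , c) ∷ []) ≡ isStandardᵇ (shrinkRow λ′ r) ν w
isStandardᵇ-∷ʳ-dull λ′ ν {r} {c} λr≡1+c νr≤c dull {w} w↭ = begin
  isStandardᵇ λ′ ν W
    ≡⟨ isStandardᵇ-all λ′ ν W ⟩
  all (standardAtᵇ λ′ ν W) (boxes λ′ ν)
    ≡⟨ all-filterᵇ (standardAtᵇ λ′ ν W) (_≢ᵇ m) (boxes λ′ ν) (λ _ b≡m → m-standard (≢ᵇ≡false⇒≡ b≡m)) ⟩
  all (standardAtᵇ λ′ ν W) (filterᵇ (_≢ᵇ m) (boxes λ′ ν))
    ≡⟨ cong (all (standardAtᵇ λ′ ν W)) (boxes-shrinkRow λ′ ν λr≡1+c νr≤c) ⟨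
  all (standardAtᵇ λ′ ν W) (boxes λ⁻ ν)
    ≡⟨ all-cong (boxes λ⁻ ν) (λ {b} b∈ → cong₂ _∧_ (precedes (⊆w b∈) (right b)) (precedes (⊆w b∈) (below b))) ⟩
  all (standardAtᵇ λ⁻ ν w) (boxes λ⁻ ν)
    ≡⟨ isStandardᵇ-all λ⁻ ν w ⟨
  isStandardᵇ λ⁻ ν w ∎
  where
  m = (r , c)
  λ⁻ = shrinkRow λ′ r
  W = w ++ m ∷ []
  ⊆w : ∀ {b} → b ∈ boxes λ⁻ ν → b ∈ w
  ⊆w b∈ = ∈-resp-↭ (↭-sym w↭) b∈
  m∉w : m ∉ w
  m∉w m∈ = proj₂ (to (InSkew-shrinkRow λ′ ν λr≡1+c m) (∈-boxes⁻ λ⁻ ν (∈-resp-↭ w↭ m∈))) refl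
  precedes = precedesᵇ-∷ʳ λ′ ν λr≡1+c m∉w ⊆w
  m-standard : ∀ {b} → b ≡ m → standardAtᵇ λ′ ν W b ≡ true
  m-standard refl rewrite proj₁ (dullᵇ⇒noNeighbours λ′ ν m dull) | proj₂ (dullᵇ⇒noNeighbours λ′ ν m dull) = refl

isStandardᵇ-∷ʳ-notDull : ∀ λ′ ν {c} → c ∈ boxes λ′ ν → dullᵇ λ′ ν c ≡ false →
  ∀ {w} → w ↭ filterᵇ (_≢ᵇ c) (boxes λ′ ν) → isStandardᵇ λ′ ν (w ++ c ∷ []) ≡ false
isStandardᵇ-∷ʳ-notDull λ′ ν {c} c∈ notDull {w} w↭ =
  trans (isStandardᵇ-all λ′ ν W) (all-false (standardAtᵇ λ′ ν W) (boxes λ′ ν) c∈ c-violates)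
  where
  W = w ++ c ∷ []
  c∉w : c ∉ w
  c∉w c∈w with trans (sym (≢ᵇ-refl c)) (proj₂ (∈-filterᵇ⁻ (_≢ᵇ c) (boxes λ′ ν) (∈-resp-↭ w↭ c∈w)))
  ... | ()
  ∈w : ∀ {x} → inSkewᵇ λ′ ν x ≡ true → x ≢ c → x ∈ w
  ∈w {x} x∈ x≢c = ∈-resp-↭ (↭-sym w↭)
    (∈-filterᵇ⁺ (_≢ᵇ c) (boxes λ′ ν) (∈-boxes⁺ λ′ ν x (inSkewᵇ⇒InSkew λ′ ν x x∈)) (≢⇒≢ᵇ x≢c))
  comes-after : ∀ {x} → inSkewᵇ λ′ ν x ≡ true → x ≢ c → precedesᵇ λ′ ν W c x ≡ false
  comes-after {x} x∈ x≢c rewrite x∈ | pos-∷ʳ w c∉w | pos-++ˡ w (c ∷ []) (∈w x∈ x≢c)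
    with pos w x | pos-∈ w (∈w x∈ x≢c)
  ... | .(suc k) | k , refl , k<len = dec-false (suc (length w) ℕ.<? suc k) (ℕP.<-asym (s≤s k<len))
  c-violates : standardAtᵇ λ′ ν W c ≡ false
  c-violates = by-cases (inSkewᵇ λ′ ν (right c)) refl (inSkewᵇ λ′ ν (below c)) refl
    where
    by-cases : ∀ p → inSkewᵇ λ′ ν (right c) ≡ p → ∀ q → inSkewᵇ λ′ ν (below c) ≡ q →
      standardAtᵇ λ′ ν W c ≡ false
    by-cases true  right∈ _     _      = cong (_∧ precedesᵇ λ′ ν W c (below c)) (comes-after right∈ (right≢ c))
    by-cases false _      true  below∈ =
      trans (cong (precedesᵇ λ′ ν W c (right c) ∧_) (comes-after below∈ (below≢ c))) (∧-zeroʳ _)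
    by-cases false right∉ false below∉ with trans (sym notDull) (cong₂ (λ p q → not p ∧ not q) right∉ below∉)
    ... | ()

sumSYT-byLastBox : ∀ λ′ ν {b} → b ∈ boxes λ′ ν → (h : List Box → ℚ) →
  sumℚ (map h (SYT λ′ ν))
  ≡ sumℚ (map (λ c → sumℚ (map (λ w → h (w ++ c ∷ [])) (SYT (shrinkRow λ′ (proj₁ c)) ν)))
              (filterᵇ (dullᵇ λ′ ν) (boxes λ′ ν)))
sumSYT-byLastBox λ′ ν b∈ h = begin
  sumℚ (map h (filterᵇ (isStandardᵇ λ′ ν) (perms B)))
    ≡⟨ sumℚ-filterᵇ (isStandardᵇ λ′ ν) h (perms B) ⟩
  sumPerms G B
    ≡⟨ sumPerms-byLast B b∈ (Unique-boxes λ′ ν) G ⟩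
  sumℚ (map (λ c → sumPerms (λ w → G (w ++ c ∷ [])) (filterᵇ (_≢ᵇ c) B)) B)
    ≡⟨ sumℚ-cong B last-box ⟩
  sumℚ (map (λ c → if dullᵇ λ′ ν c then K c else 0ℚ) B)
    ≡⟨ sumℚ-filterᵇ (dullᵇ λ′ ν) K B ⟨
  sumℚ (map K (filterᵇ (dullᵇ λ′ ν) B)) ∎
  where
  B = boxes λ′ ν
  G : List Box → ℚ
  G w = if isStandardᵇ λ′ ν w then h w else 0ℚ
  K : Box → ℚ
  K c = sumℚ (map (λ w → h (w ++ c ∷ [])) (SYT (shrinkRow λ′ (proj₁ c)) ν))
  last-box : ∀ {c} → c ∈ B →
    sumPerms (λ w → G (w ++ c ∷ [])) (filterᵇ (_≢ᵇ c) B) ≡ (if dullᵇ λ′ ν c then K c else 0ℚ)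
  last-box {c} c∈ with dullᵇ λ′ ν c in dull
  ... | false = sumℚ-zero (λ w → G (w ++ c ∷ [])) (perms (filterᵇ (_≢ᵇ c) B))
    (λ {w} w∈ → cong (λ s → if s then h (w ++ c ∷ []) else 0ℚ)
                     (isStandardᵇ-∷ʳ-notDull λ′ ν c∈ dull (∈-perms-↭ (filterᵇ (_≢ᵇ c) B) w∈)))
  last-box {c@(r , c₀)} c∈ | true = begin
    sumPerms (λ w → G (w ++ c ∷ [])) (filterᵇ (_≢ᵇ c) B)
      ≡⟨ cong (sumPerms (λ w → G (w ++ c ∷ []))) (boxes-shrinkRow λ′ ν λr≡1+c₀ (proj₁ c∈λ/ν)) ⟨
    sumPerms (λ w → G (w ++ c ∷ [])) (boxes λ⁻ ν)
      ≡⟨ sumℚ-cong (perms (boxes λ⁻ ν)) (λ {w} w∈ → cong (λ s → if s then h (w ++ c ∷ []) else 0ℚ)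
           (isStandardᵇ-∷ʳ-dull λ′ ν λr≡1+c₀ (proj₁ c∈λ/ν) dull (∈-perms-↭ (boxes λ⁻ ν) w∈))) ⟩
    sumℚ (map (λ w → if isStandardᵇ λ⁻ ν w then h (w ++ c ∷ []) else 0ℚ) (perms (boxes λ⁻ ν)))
      ≡⟨ sumℚ-filterᵇ (isStandardᵇ λ⁻ ν) (λ w → h (w ++ c ∷ [])) (perms (boxes λ⁻ ν)) ⟨
    K c ∎
    where
    λ⁻ = shrinkRow λ′ r
    c∈λ/ν = ∈-boxes⁻ λ′ ν c∈
    λr≡1+c₀ = dull⇒lastInRow λ′ ν c∈λ/ν dull

-- The right-hand side as a product over boxes

adjacencyProduct : List ℕ → List ℕ → List Box → (Box → ℚ) → ℚ
adjacencyProduct λ′ ν B y =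
  prodℚ (map (λ b → y (right b) - y b) (filterᵇ (λ b → inSkewᵇ λ′ ν (right b)) B))
  * prodℚ (map (λ b → y (below b) - y b) (filterᵇ (λ b → inSkewᵇ λ′ ν (below b)) B))

-- RHS with the value y b of each box b in place of x (label b).
boxRHS : List ℕ → List ℕ → Box → (Box → ℚ) → ℚ
boxRHS λ′ ν m y =
  (prodℚ (map (λ s → y m - y s) (filterᵇ (sharpᵇ λ′ ν) B))
   * inv (prodℚ (map (λ d → y m - y d) (filterᵇ (_≢ᵇ m) (filterᵇ (dullᵇ λ′ ν) B)))))
  * inv (adjacencyProduct λ′ ν B y)
  where B = boxes λ′ ν

shapeFraction : List ℕ → List ℕ → List Box → ℚ → (Box → ℚ) → ℚ
shapeFraction λ′ ν B t y =
  (prodℚ (map (λ s → t - y s) (filterᵇ (sharpᵇ λ′ ν) B))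
   * inv (prodℚ (map (λ d → t - y d) (filterᵇ (dullᵇ λ′ ν) B))))
  * inv (adjacencyProduct λ′ ν B y)

boxFactor : Bool → Bool → ℚ → ℚ → ℚ → ℚ
boxFactor hasRight hasBelow Δ Δʳ Δᵇ =
  (if hasBelow ∧ hasRight then Δ else 1ℚ) * inv (if not hasRight ∧ not hasBelow then Δ else 1ℚ)
  * inv ((if hasRight then Δʳ else 1ℚ) * (if hasBelow then Δᵇ else 1ℚ))

localFactor : List ℕ → List ℕ → ℚ → (Box → ℚ) → Box → ℚ
localFactor λ′ ν t y b =
  boxFactor (inSkewᵇ λ′ ν (right b)) (inSkewᵇ λ′ ν (below b)) (t - y b) (y (right b) - y b) (y (below b) - y b)

shapeFraction-as-product : ∀ λ′ ν B t y → shapeFraction λ′ ν B t y ≡ prodℚ (map (localFactor λ′ ν t y) B)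
shapeFraction-as-product λ′ ν B t y = begin
  prodℚ (map (λ s → t - y s) (filterᵇ (sharpᵇ λ′ ν) B))
    * inv (prodℚ (map (λ d → t - y d) (filterᵇ (dullᵇ λ′ ν) B))) * inv (adjacencyProduct λ′ ν B y)
    ≡⟨ cong₂ (λ p q → p * inv q * inv (adjacencyProduct λ′ ν B y))
         (prodℚ-filterᵇ (sharpᵇ λ′ ν) (λ s → t - y s) B) (prodℚ-filterᵇ (dullᵇ λ′ ν) (λ d → t - y d) B) ⟩
  prodℚ (map S B) * inv (prodℚ (map D B)) * inv (adjacencyProduct λ′ ν B y)
    ≡⟨ cong₂ (λ p q → prodℚ (map S B) * inv (prodℚ (map D B)) * inv (p * q))
         (prodℚ-filterᵇ (λ b → inSkewᵇ λ′ ν (right b)) (λ b → y (right b) - y b) B)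
         (prodℚ-filterᵇ (λ b → inSkewᵇ λ′ ν (below b)) (λ b → y (below b) - y b) B) ⟩
  prodℚ (map S B) * inv (prodℚ (map D B)) * inv (prodℚ (map R B) * prodℚ (map L B))
    ≡⟨ cong (λ p → prodℚ (map S B) * inv (prodℚ (map D B)) * inv p) (prodℚ-* R L B) ⟨
  prodℚ (map S B) * inv (prodℚ (map D B)) * inv (prodℚ (map (λ b → R b * L b) B))
    ≡⟨ cong₂ (λ p q → prodℚ (map S B) * p * q) (inv-prodℚ D B) (inv-prodℚ (λ b → R b * L b) B) ⟩
  prodℚ (map S B) * prodℚ (map (inv ∘ D) B) * prodℚ (map (λ b → inv (R b * L b)) B)
    ≡⟨ cong (_* prodℚ (map (λ b → inv (R b * L b)) B)) (prodℚ-* S (inv ∘ D) B) ⟨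
  prodℚ (map (λ b → S b * inv (D b)) B) * prodℚ (map (λ b → inv (R b * L b)) B)
    ≡⟨ prodℚ-* (λ b → S b * inv (D b)) (λ b → inv (R b * L b)) B ⟨
  prodℚ (map (localFactor λ′ ν t y) B) ∎
  where
  S D R L : Box → ℚ
  S b = if sharpᵇ λ′ ν b then t - y b else 1ℚ
  D b = if dullᵇ λ′ ν b then t - y b else 1ℚ
  R b = if inSkewᵇ λ′ ν (right b) then y (right b) - y b else 1ℚ
  L b = if inSkewᵇ λ′ ν (below b) then y (below b) - y b else 1ℚ

filterᵇ-without : ∀ (p : Box → Bool) {m} xs → p m ≡ false → filterᵇ p xs ≡ filterᵇ p (filterᵇ (_≢ᵇ m) xs)
filterᵇ-without p {m} xs pm≡false = trans
  (sym (filterᵇ-all (_≢ᵇ m) (filterᵇ p xs)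
    (λ {b} b∈ → ≢⇒≢ᵇ (λ b≡m → p≢ (trans (cong p (sym b≡m)) (proj₂ (∈-filterᵇ⁻ p xs b∈)))))))
  (filterᵇ-comm (_≢ᵇ m) p xs)
  where
  p≢ : p m ≢ true
  p≢ pm≡true with trans (sym pm≡false) pm≡true
  ... | ()

boxRHS-as-shapeFraction : ∀ λ′ ν {r c} → row λ′ r ≡ suc c → row ν r ≤ c → dullᵇ λ′ ν (r , c) ≡ true → ∀ y →
  boxRHS λ′ ν (r , c) y ≡ shapeFraction λ′ ν (boxes (shrinkRow λ′ r) ν) (y (r , c)) y
boxRHS-as-shapeFraction λ′ ν {r} {c} λr≡1+c νr≤c dull y
  rewrite boxes-shrinkRow λ′ ν λr≡1+c νr≤c =
  cong₂ (λ p q → p * inv q)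
    (cong₂ (λ S D → prodℚ (map (λ s → y m - y s) S) * inv (prodℚ (map (λ d → y m - y d) D)))
      (filterᵇ-without (sharpᵇ λ′ ν) B (trans (cong (_∧ inSkewᵇ λ′ ν (right m)) noBelow) refl))
      (filterᵇ-comm (_≢ᵇ m) (dullᵇ λ′ ν) B))
    (cong₂ (λ R L → prodℚ (map (λ b → y (right b) - y b) R) * prodℚ (map (λ b → y (below b) - y b) L))
      (filterᵇ-without (λ b → inSkewᵇ λ′ ν (right b)) B noRight)
      (filterᵇ-without (λ b → inSkewᵇ λ′ ν (below b)) B noBelow))
  where
  m = (r , c)
  B = boxes λ′ ν
  noRight = proj₁ (dullᵇ⇒noNeighbours λ′ ν m dull)
  noBelow = proj₂ (dullᵇ⇒noNeighbours λ′ ν m dull)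

boxFactor-rightRemoved : ∀ hasBelow {Δ} Δʳ Δᵇ → Δ ≢ 0ℚ →
  boxFactor false hasBelow Δ Δʳ Δᵇ ≡ boxFactor true hasBelow Δ Δ Δᵇ
boxFactor-rightRemoved true {Δ} Δʳ Δᵇ Δ≢0 = begin
  1ℚ * inv (1ℚ * Δᵇ)      ≡⟨ ℚP.*-identityˡ _ ⟩
  inv (1ℚ * Δᵇ)           ≡⟨ cong inv (ℚP.*-identityˡ Δᵇ) ⟩
  inv Δᵇ                  ≡⟨ *-inv-cancelˡ Δᵇ Δ≢0 ⟨
  Δ * inv (Δ * Δᵇ)        ≡⟨ cong (_* inv (Δ * Δᵇ)) (ℚP.*-identityʳ Δ) ⟨
  Δ * 1ℚ * inv (Δ * Δᵇ)   ∎
boxFactor-rightRemoved false {Δ} Δʳ Δᵇ Δ≢0 = begin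
  1ℚ * inv Δ * 1ℚ        ≡⟨ ℚP.*-identityʳ _ ⟩
  1ℚ * inv Δ             ≡⟨ cong (1ℚ *_) (cong inv (ℚP.*-identityʳ Δ)) ⟨
  1ℚ * inv (Δ * 1ℚ)      ∎

boxFactor-belowRemoved : ∀ hasRight {Δ} Δʳ Δᵇ → Δ ≢ 0ℚ →
  boxFactor hasRight false Δ Δʳ Δᵇ ≡ boxFactor hasRight true Δ Δʳ Δ
boxFactor-belowRemoved true {Δ} Δʳ Δᵇ Δ≢0 = begin
  1ℚ * inv (Δʳ * 1ℚ)      ≡⟨ ℚP.*-identityˡ _ ⟩
  inv (Δʳ * 1ℚ)           ≡⟨ cong inv (ℚP.*-comm Δʳ 1ℚ) ⟩
  inv (1ℚ * Δʳ)           ≡⟨ cong inv (ℚP.*-identityˡ Δʳ) ⟩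
  inv Δʳ                  ≡⟨ *-inv-cancelˡ Δʳ Δ≢0 ⟨
  Δ * inv (Δ * Δʳ)        ≡⟨ cong (λ z → Δ * inv z) (ℚP.*-comm Δ Δʳ) ⟩
  Δ * inv (Δʳ * Δ)        ≡⟨ cong (_* inv (Δʳ * Δ)) (ℚP.*-identityʳ Δ) ⟨
  Δ * 1ℚ * inv (Δʳ * Δ)   ∎
boxFactor-belowRemoved false {Δ} Δʳ Δᵇ Δ≢0 = begin
  1ℚ * inv Δ * 1ℚ        ≡⟨ ℚP.*-identityʳ _ ⟩
  1ℚ * inv Δ             ≡⟨ cong (1ℚ *_) (cong inv (ℚP.*-identityˡ Δ)) ⟨
  1ℚ * inv (1ℚ * Δ)      ∎

localFactor-shrinkRow : ∀ λ′ ν {r c} → row λ′ r ≡ suc c → row ν r ≤ c → ∀ y {b} → y (r , c) ≢ y b →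
  localFactor (shrinkRow λ′ r) ν (y (r , c)) y b ≡ localFactor λ′ ν (y (r , c)) y b
localFactor-shrinkRow λ′ ν {r} {c} λr≡1+c νr≤c y {b} ym≢yb = by-cases (right b ≟B m) (below b ≟B m)
  where
  m = (r , c)
  λ⁻ = shrinkRow λ′ r
  Δ = y m - y b
  Δʳ = y (right b) - y b
  Δᵇ = y (below b) - y b
  Δ≢0 = p≢q⇒p-q≢0 ym≢yb
  m∉λ⁻ : inSkewᵇ λ⁻ ν m ≡ false
  m∉λ⁻ = ¬InSkew⇒inSkewᵇ λ⁻ ν m (λ m∈ → proj₂ (to (InSkew-shrinkRow λ′ ν λr≡1+c m) m∈) refl)
  kept : ∀ x → x ≢ m → inSkewᵇ λ⁻ ν x ≡ inSkewᵇ λ′ ν x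
  kept x x≢m =
    trans (inSkewᵇ-shrinkRow λ′ ν λr≡1+c x) (trans (cong (inSkewᵇ λ′ ν x ∧_) (≢⇒≢ᵇ x≢m)) (∧-identityʳ _))
  by-cases : Dec (right b ≡ m) → Dec (below b ≡ m) → localFactor λ⁻ ν (y m) y b ≡ localFactor λ′ ν (y m) y b
  by-cases (yes right≡m) (yes below≡m) = ⊥-elim (right≢below b (trans right≡m (sym below≡m)))
  by-cases (yes right≡m) (no below≢m) = begin
    boxFactor (inSkewᵇ λ⁻ ν (right b)) (inSkewᵇ λ⁻ ν (below b)) Δ Δʳ Δᵇ
      ≡⟨ cong₂ (λ p q → boxFactor p q Δ Δʳ Δᵇ) (trans (cong (inSkewᵇ λ⁻ ν) right≡m) m∉λ⁻) (kept (below b) below≢m) ⟩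
    boxFactor false (inSkewᵇ λ′ ν (below b)) Δ Δʳ Δᵇ
      ≡⟨ boxFactor-rightRemoved (inSkewᵇ λ′ ν (below b)) Δʳ Δᵇ Δ≢0 ⟩
    boxFactor true (inSkewᵇ λ′ ν (below b)) Δ Δ Δᵇ
      ≡⟨ cong₂ (λ p q → boxFactor p (inSkewᵇ λ′ ν (below b)) Δ q Δᵇ)
           (sym (trans (cong (inSkewᵇ λ′ ν) right≡m) (inSkewᵇ-lastInRow λ′ ν λr≡1+c νr≤c)))
           (cong (λ z → y z - y b) (sym right≡m)) ⟩
    boxFactor (inSkewᵇ λ′ ν (right b)) (inSkewᵇ λ′ ν (below b)) Δ Δʳ Δᵇ ∎
  by-cases (no right≢m) (yes below≡m) = begin
    boxFactor (inSkewᵇ λ⁻ ν (right b)) (inSkewᵇ λ⁻ ν (below b)) Δ Δʳ Δᵇ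
      ≡⟨ cong₂ (λ p q → boxFactor p q Δ Δʳ Δᵇ) (kept (right b) right≢m) (trans (cong (inSkewᵇ λ⁻ ν) below≡m) m∉λ⁻) ⟩
    boxFactor (inSkewᵇ λ′ ν (right b)) false Δ Δʳ Δᵇ
      ≡⟨ boxFactor-belowRemoved (inSkewᵇ λ′ ν (right b)) Δʳ Δᵇ Δ≢0 ⟩
    boxFactor (inSkewᵇ λ′ ν (right b)) true Δ Δʳ Δ
      ≡⟨ cong₂ (λ p q → boxFactor (inSkewᵇ λ′ ν (right b)) p Δ Δʳ q)
           (sym (trans (cong (inSkewᵇ λ′ ν) below≡m) (inSkewᵇ-lastInRow λ′ ν λr≡1+c νr≤c)))
           (cong (λ z → y z - y b) (sym below≡m)) ⟩
    boxFactor (inSkewᵇ λ′ ν (right b)) (inSkewᵇ λ′ ν (below b)) Δ Δʳ Δᵇ ∎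
  by-cases (no right≢m) (no below≢m) =
    cong₂ (λ p q → boxFactor p q Δ Δʳ Δᵇ) (kept (right b) right≢m) (kept (below b) below≢m)

shapeFraction-shrinkRow≡boxRHS : ∀ λ′ ν {r c} → row λ′ r ≡ suc c → row ν r ≤ c → dullᵇ λ′ ν (r , c) ≡ true →
  ∀ (y : Box → ℚ) → InjectiveOn y (boxes λ′ ν) →
  shapeFraction (shrinkRow λ′ r) ν (boxes (shrinkRow λ′ r) ν) (y (r , c)) y ≡ boxRHS λ′ ν (r , c) y
shapeFraction-shrinkRow≡boxRHS λ′ ν {r} {c} λr≡1+c νr≤c dull y y-inj = begin
  shapeFraction λ⁻ ν B⁻ (y m) y          ≡⟨ shapeFraction-as-product λ⁻ ν B⁻ (y m) y ⟩
  prodℚ (map (localFactor λ⁻ ν (y m) y) B⁻)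
    ≡⟨ prodℚ-cong B⁻ (λ b∈ →
         localFactor-shrinkRow λ′ ν λr≡1+c νr≤c y (InjectiveOn-shrinkRow λ′ ν λr≡1+c νr≤c y y-inj b∈)) ⟩
  prodℚ (map (localFactor λ′ ν (y m) y) B⁻) ≡⟨ shapeFraction-as-product λ′ ν B⁻ (y m) y ⟨
  shapeFraction λ′ ν B⁻ (y m) y          ≡⟨ boxRHS-as-shapeFraction λ′ ν λr≡1+c νr≤c dull y ⟨
  boxRHS λ′ ν m y                           ∎
  where
  m = (r , c)
  λ⁻ = shrinkRow λ′ r
  B⁻ = boxes λ⁻ ν

-- Summed over the possible boxes c of the second largest entry, the induction hypotheses
-- combine by partial fractions in t = y m.
sum-boxRHS≡shapeFraction : ∀ λ′ ν t y →
  length (filterᵇ (sharpᵇ λ′ ν) (boxes λ′ ν)) < length (filterᵇ (dullᵇ λ′ ν) (boxes λ′ ν)) →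
  Unique (t ∷ map y (filterᵇ (dullᵇ λ′ ν) (boxes λ′ ν))) →
  sumℚ (map (λ c → boxRHS λ′ ν c y * inv (t - y c)) (filterᵇ (dullᵇ λ′ ν) (boxes λ′ ν)))
  ≡ shapeFraction λ′ ν (boxes λ′ ν) t y
sum-boxRHS≡shapeFraction λ′ ν t y #S<#D t∷D! = begin
  sumℚ (map (λ c → boxRHS λ′ ν c y * inv (t - y c)) D)
    ≡⟨ sumℚ-cong D (λ {c} _ → reassociate c) ⟩
  sumℚ (map (λ c → term t S (c , filterᵇ (_≢ᵇ c) D) * inv E) D)
    ≡⟨ sumℚ-* (inv E) (λ c → term t S (c , filterᵇ (_≢ᵇ c) D)) D ⟩
  sumℚ (map (λ c → term t S (c , filterᵇ (_≢ᵇ c) D)) D) * inv E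
    ≡⟨ cong (_* inv E)
         (sumℚ-selects (λ c es → term t S (c , es)) D (Unique-filterᵇ (dullᵇ λ′ ν) (Unique-boxes λ′ ν))) ⟨
  termSum t S D * inv E
    ≡⟨ cong (_* inv E) (termSum≡fraction S D t #S<#D t∷D!) ⟩
  shapeFraction λ′ ν (boxes λ′ ν) t y ∎
  where
  open Lagrange y
  S = filterᵇ (sharpᵇ λ′ ν) (boxes λ′ ν)
  D = filterᵇ (dullᵇ λ′ ν) (boxes λ′ ν)
  E = adjacencyProduct λ′ ν (boxes λ′ ν) y
  reassociate : ∀ c → boxRHS λ′ ν c y * inv (t - y c) ≡ term t S (c , filterᵇ (_≢ᵇ c) D) * inv E
  reassociate c = solve 4 (λ a b e v → (a :* b) :* e :* v := a :* b :* v :* e) refl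
    (prodℚ (map (λ s → y c - y s) S)) (inv (prodℚ (map (λ d → y c - y d) (filterᵇ (_≢ᵇ c) D)))) (inv E) (inv (t - y c))

-- Fewer sharp corners than dull boxes

module _ (λ′ ν : List ℕ) where

  lastInRow-dull : ∀ {r c} → row λ′ r ≡ suc c → row λ′ (suc r) ≤ c → dullᵇ λ′ ν (r , c) ≡ true
  lastInRow-dull {r} {c} λr≡1+c λ[1+r]≤c = cong₂ (λ p q → not p ∧ not q)
    (¬InSkew⇒inSkewᵇ λ′ ν (r , suc c) (λ (_ , 1+c<λr) → ℕP.<-irrefl (sym λr≡1+c) 1+c<λr))
    (¬InSkew⇒inSkewᵇ λ′ ν (suc r , c) (λ (_ , c<λ[1+r]) → ℕP.<-irrefl refl (ℕP.<-≤-trans c<λ[1+r] λ[1+r]≤c)))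

  lastInRow-#dull>0 : ∀ {r c} → row λ′ r ≡ suc c → row ν r ≤ c → row λ′ (suc r) ≤ c →
    0 < length (filterᵇ (dullᵇ λ′ ν) (rowBoxes λ′ ν r))
  lastInRow-#dull>0 {r} {c} λr≡1+c νr≤c λ[1+r]≤c = ∈-length
    (∈-filterᵇ⁺ (dullᵇ λ′ ν) (rowBoxes λ′ ν r)
      (∈-rowBoxes⁺ λ′ ν (νr≤c , subst (c <_) (sym λr≡1+c) (ℕP.n<1+n c)))
      (lastInRow-dull λr≡1+c λ[1+r]≤c))

  module _ (bbs : BrokenBorderStrip λ′ ν) where

    sharp⇒cornerBelow : ∀ {r c} → InSkew λ′ ν (r , c) → sharpᵇ λ′ ν (r , c) ≡ true →
      row λ′ (suc r) ≡ suc c × suc c < row λ′ r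
    sharp⇒cornerBelow {r} {c} rc∈ sharp with to T-∧ (from T-≡ sharp)
    ... | below∈ , right∈ = ℕP.≤-antisym (ℕP.≮⇒≥ no-diagonal) (proj₂ below∈λ) , proj₂ right∈λ
      where
      below∈λ = inSkewᵇ⇒InSkew λ′ ν (suc r , c) (to T-≡ below∈)
      right∈λ = inSkewᵇ⇒InSkew λ′ ν (r , suc c) (to T-≡ right∈)
      no-diagonal : ¬ suc c < row λ′ (suc r)
      no-diagonal 1+c< = bbs r c (rc∈ , right∈λ , below∈λ , ℕP.m≤n⇒m≤1+n (proj₁ below∈λ) , 1+c<)

    ∈-sharpsInRow : ∀ {r b} → b ∈ filterᵇ (sharpᵇ λ′ ν) (rowBoxes λ′ ν r) →
      ∃ λ c → b ≡ (r , c) × row ν r ≤ c × row λ′ (suc r) ≡ suc c × suc c < row λ′ r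
    ∈-sharpsInRow {r} {b} b∈ with ∈-filterᵇ⁻ (sharpᵇ λ′ ν) (rowBoxes λ′ ν r) b∈
    ... | b∈row , sharp with ∈-rowBoxes⁻ λ′ ν {r} b∈row
    ...   | refl , b∈λ/ν = proj₂ b , refl , proj₁ b∈λ/ν , sharp⇒cornerBelow b∈λ/ν sharp

    row-#sharp≤#dull : ∀ r →
      length (filterᵇ (sharpᵇ λ′ ν) (rowBoxes λ′ ν r)) ≤ length (filterᵇ (dullᵇ λ′ ν) (rowBoxes λ′ ν r))
    row-#sharp≤#dull r with filterᵇ (sharpᵇ λ′ ν) (rowBoxes λ′ ν r) in sharps
    ... | []    = z≤n
    ... | s ∷ ss with ∈-sharpsInRow (subst (s ∈_) (sym sharps) (here refl))
    ...   | c , refl , νr≤c , λ[1+r]≡1+c , 1+c<λr =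
      ℕP.≤-trans (Unique-length≤1 sharps! same-column) (lastInRow-#dull>0 λr≡1+c′ νr≤c′ λ[1+r]≤c′)
      where
      c′ = pred (row λ′ r)
      λr≡1+c′ : row λ′ r ≡ suc c′
      λr≡1+c′ = <⇒≡suc-pred 1+c<λr
      c<c′ : c < c′
      c<c′ = ℕP.≤-pred (subst (suc (suc c) ≤_) λr≡1+c′ 1+c<λr)
      νr≤c′ : row ν r ≤ c′
      νr≤c′ = ℕP.≤-trans νr≤c (ℕP.<⇒≤ c<c′)
      λ[1+r]≤c′ : row λ′ (suc r) ≤ c′
      λ[1+r]≤c′ = subst (_≤ c′) (sym λ[1+r]≡1+c) c<c′
      sharps! = subst Unique sharps
        (Unique-filterᵇ (sharpᵇ λ′ ν) (Unique.map⁺ (cong proj₂) (Unique-range (row ν r) (row λ′ r))))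
      same-column : ∀ {a b} → a ∈ (r , c) ∷ ss → b ∈ (r , c) ∷ ss → a ≡ b
      same-column {a} {b} a∈ b∈
        with ∈-sharpsInRow (subst (a ∈_) (sym sharps) a∈) | ∈-sharpsInRow (subst (b ∈_) (sym sharps) b∈)
      ... | _ , refl , _ , λ≡1+a , _ | _ , refl , _ , λ≡1+b , _ = cong (r ,_) (ℕP.suc-injective (trans (sym λ≡1+a) λ≡1+b))

  lastNonemptyRow : ∀ k r → length λ′ ≤ r ℕ.+ k → row ν r < row λ′ r →
    ∃ λ R → R < length λ′ × row ν R < row λ′ R × row λ′ (suc R) ≤ row ν (suc R)
  lastNonemptyRow zero    r len≤r νr<λr =
    ⊥-elim (ℕP.n≮0 (subst (row ν r <_) (row-≥length λ′ (subst (length λ′ ≤_) (ℕP.+-identityʳ r) len≤r)) νr<λr))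
  lastNonemptyRow (suc k) r len≤ νr<λr with row ν (suc r) ℕ.<? row λ′ (suc r)
  ... | yes ν<λ-next = lastNonemptyRow k (suc r) (subst (length λ′ ≤_) (ℕP.+-suc r k) len≤) ν<λ-next
  ... | no  ν≮λ-next = r , InSkew⇒row< λ′ ν {r} {row ν r} (ℕP.≤-refl , νr<λr) , νr<λr , ℕP.≮⇒≥ ν≮λ-next

  sharpsInRow-none : ∀ {r} → row λ′ (suc r) ≤ row ν (suc r) → filterᵇ (sharpᵇ λ′ ν) (rowBoxes λ′ ν r) ≡ []
  sharpsInRow-none {r} λ≤ν = filterᵇ-none (sharpᵇ λ′ ν) (rowBoxes λ′ ν r) not-sharp
    where
    not-sharp : ∀ {b} → b ∈ rowBoxes λ′ ν r → sharpᵇ λ′ ν b ≡ false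
    not-sharp {b} b∈ with ∈-rowBoxes⁻ λ′ ν {r} b∈
    ... | refl , _ = cong (_∧ inSkewᵇ λ′ ν (right b))
      (¬InSkew⇒inSkewᵇ λ′ ν (below b) (λ (ν≤c , c<λ) → ℕP.<-irrefl refl (ℕP.<-≤-trans c<λ (ℕP.≤-trans λ≤ν ν≤c))))

  #sharp<#dull : (∀ r → row ν (suc r) ≤ row ν r) → BrokenBorderStrip λ′ ν → ∀ {b} → b ∈ boxes λ′ ν →
    length (filterᵇ (sharpᵇ λ′ ν) (boxes λ′ ν)) < length (filterᵇ (dullᵇ λ′ ν) (boxes λ′ ν))
  #sharp<#dull ν-antitone bbs {r , c} b∈ with ∈-boxes⁻ λ′ ν b∈
  ... | νr≤c , c<λr with lastNonemptyRow (length λ′) r (ℕP.m≤n+m (length λ′) r) (ℕP.≤-<-trans νr≤c c<λr)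
  ...   | R , R<len , νR<λR , λ[1+R]≤ν[1+R] =
    length-filterᵇ-concatMap-< (sharpᵇ λ′ ν) (dullᵇ λ′ ν) (rowBoxes λ′ ν) (row-#sharp≤#dull bbs)
      (upTo (length λ′)) (∈-upTo⁺ R<len) last-row
    where
    c′ = pred (row λ′ R)
    λR≡1+c′ : row λ′ R ≡ suc c′
    λR≡1+c′ = <⇒≡suc-pred νR<λR
    νR≤c′ : row ν R ≤ c′
    νR≤c′ = ℕP.≤-pred (subst (suc (row ν R) ≤_) λR≡1+c′ νR<λR)
    last-row : length (filterᵇ (sharpᵇ λ′ ν) (rowBoxes λ′ ν R)) < length (filterᵇ (dullᵇ λ′ ν) (rowBoxes λ′ ν R))
    last-row rewrite sharpsInRow-none λ[1+R]≤ν[1+R] =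
      lastInRow-#dull>0 λR≡1+c′ νR≤c′ (ℕP.≤-trans λ[1+R]≤ν[1+R] (ℕP.≤-trans (ν-antitone R) νR≤c′))

-- Induction on the number of boxes

chain : ∀ {A : Set} → (A → ℚ) → List A → ℚ
chain y []           = 1ℚ
chain y (a ∷ [])     = 1ℚ
chain y (a ∷ b ∷ as) = (y b - y a) * chain y (b ∷ as)

chain-∷ʳ : ∀ {A : Set} (y : A → ℚ) w c m → chain y (w ++ c ∷ m ∷ []) ≡ chain y (w ++ c ∷ []) * (y m - y c)
chain-∷ʳ y []          c m = ℚP.*-comm (y m - y c) 1ℚ
chain-∷ʳ y (a ∷ [])    c m = solve 2 (λ u v → u :* (v :* con 1ℚ) := u :* con 1ℚ :* v) refl (y c - y a) (y m - y c)
chain-∷ʳ y (a ∷ b ∷ w) c m =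
  trans (cong ((y b - y a) *_) (chain-∷ʳ y (b ∷ w) c m)) (sym (ℚP.*-assoc (y b - y a) _ _))

-- X with the value y b of each box b in place of x (label b).
boxX : List ℕ → List ℕ → Box → (Box → ℚ) → ℚ
boxX μ ν m y = sumℚ (map (λ w → inv (chain y (w ++ m ∷ []))) (SYT μ ν))

module RemoveDullBox (λ′ ν : List ℕ) (ν-antitone : ∀ r → row ν (suc r) ≤ row ν r) (bbs : BrokenBorderStrip λ′ ν)
                     (y : Box → ℚ) (y-inj : InjectiveOn y (boxes λ′ ν))
                     {r c : ℕ} (λr≡1+c : row λ′ r ≡ suc c) (νr≤c : row ν r ≤ c)
                     (dull : dullᵇ λ′ ν (r , c) ≡ true) where

  private
    m = (r , c)
    λ⁻ = shrinkRow λ′ r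
    D⁻ = filterᵇ (dullᵇ λ⁻ ν) (boxes λ⁻ ν)

  boxX-noBoxesLeft : boxes λ⁻ ν ≡ [] → boxX λ⁻ ν m y ≡ boxRHS λ′ ν m y
  boxX-noBoxesLeft boxes⁻≡[] = begin
    boxX λ⁻ ν m y                                ≡⟨ cong (sumℚ ∘ map (λ w → inv (chain y (w ++ m ∷ [])))) SYT⁻≡[[]] ⟩
    1ℚ                                           ≡⟨ cong (λ B → shapeFraction λ⁻ ν B (y m) y) boxes⁻≡[] ⟨
    shapeFraction λ⁻ ν (boxes λ⁻ ν) (y m) y      ≡⟨ shapeFraction-shrinkRow≡boxRHS λ′ ν λr≡1+c νr≤c dull y y-inj ⟩
    boxRHS λ′ ν m y                              ∎
    where
    SYT⁻≡[[]] : SYT λ⁻ ν ≡ [] ∷ []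
    SYT⁻≡[[]] = trans (cong (filterᵇ (isStandardᵇ λ⁻ ν) ∘ perms) boxes⁻≡[])
      (filterᵇ-accept (isStandardᵇ λ⁻ ν) [] (trans (isStandardᵇ-all λ⁻ ν []) (cong (all (standardAtᵇ λ⁻ ν [])) boxes⁻≡[])))

  boxX-lastBox : ∀ {d} → boxX (shrinkRow λ⁻ (proj₁ d)) ν d y ≡ boxRHS λ⁻ ν d y →
    sumℚ (map (λ w → inv (chain y ((w ++ d ∷ []) ++ m ∷ []))) (SYT (shrinkRow λ⁻ (proj₁ d)) ν))
    ≡ boxRHS λ⁻ ν d y * inv (y m - y d)
  boxX-lastBox {d} IH = begin
    sumℚ (map (λ w → inv (chain y ((w ++ d ∷ []) ++ m ∷ []))) T)
      ≡⟨ cong sumℚ (map-cong split T) ⟩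
    sumℚ (map (λ w → inv (chain y (w ++ d ∷ [])) * inv (y m - y d)) T)
      ≡⟨ sumℚ-* (inv (y m - y d)) (λ w → inv (chain y (w ++ d ∷ []))) T ⟩
    boxX (shrinkRow λ⁻ (proj₁ d)) ν d y * inv (y m - y d)
      ≡⟨ cong (_* inv (y m - y d)) IH ⟩
    boxRHS λ⁻ ν d y * inv (y m - y d) ∎
    where
    T = SYT (shrinkRow λ⁻ (proj₁ d)) ν
    split : ∀ w → inv (chain y ((w ++ d ∷ []) ++ m ∷ [])) ≡ inv (chain y (w ++ d ∷ [])) * inv (y m - y d)
    split w = trans (cong (inv ∘ chain y) (++-assoc w (d ∷ []) (m ∷ [])))
                    (trans (cong inv (chain-∷ʳ y w d m)) (inv-* (chain y (w ++ d ∷ [])) (y m - y d)))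

  boxX-step : ∀ {b} → b ∈ boxes λ⁻ ν →
    (∀ {d} → d ∈ D⁻ → boxX (shrinkRow λ⁻ (proj₁ d)) ν d y ≡ boxRHS λ⁻ ν d y) →
    boxX λ⁻ ν m y ≡ boxRHS λ′ ν m y
  boxX-step b∈ IH = begin
    boxX λ⁻ ν m y
      ≡⟨ sumSYT-byLastBox λ⁻ ν b∈ (λ w → inv (chain y (w ++ m ∷ []))) ⟩
    sumℚ (map (λ d → sumℚ (map (λ w → inv (chain y ((w ++ d ∷ []) ++ m ∷ []))) (SYT (shrinkRow λ⁻ (proj₁ d)) ν))) D⁻)
      ≡⟨ sumℚ-cong D⁻ (boxX-lastBox ∘ IH) ⟩
    sumℚ (map (λ d → boxRHS λ⁻ ν d y * inv (y m - y d)) D⁻)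
      ≡⟨ sum-boxRHS≡shapeFraction λ⁻ ν (y m) y
           (#sharp<#dull λ⁻ ν ν-antitone (BrokenBorderStrip-shrinkRow λ′ ν r bbs) b∈) ym∷D⁻! ⟩
    shapeFraction λ⁻ ν (boxes λ⁻ ν) (y m) y
      ≡⟨ shapeFraction-shrinkRow≡boxRHS λ′ ν λr≡1+c νr≤c dull y y-inj ⟩
    boxRHS λ′ ν m y ∎
    where
    D⁻⊆ : ∀ {d} → d ∈ D⁻ → d ∈ boxes λ⁻ ν
    D⁻⊆ = proj₁ ∘ ∈-filterᵇ⁻ (dullᵇ λ⁻ ν) (boxes λ⁻ ν)
    ym∷D⁻! : Unique (y m ∷ map y D⁻)
    ym∷D⁻! = All.map⁺ (All.tabulate (InjectiveOn-shrinkRow λ′ ν λr≡1+c νr≤c y y-inj ∘ D⁻⊆))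
      ∷ Unique-map-on y (InjectiveOn-⊆ (boxes-shrinkRow-⊆ λ′ ν r ∘ D⁻⊆) y-inj)
          (Unique-filterᵇ (dullᵇ λ⁻ ν) (Unique-boxes λ⁻ ν))

boxX≡boxRHS : ∀ k λ′ ν → length (boxes λ′ ν) ≤ k →
  (∀ r → row ν (suc r) ≤ row ν r) → BrokenBorderStrip λ′ ν →
  ∀ (y : Box → ℚ) → InjectiveOn y (boxes λ′ ν) → ∀ {r c} → InSkew λ′ ν (r , c) → dullᵇ λ′ ν (r , c) ≡ true →
  boxX (shrinkRow λ′ r) ν (r , c) y ≡ boxRHS λ′ ν (r , c) y
boxX≡boxRHS zero λ′ ν #boxes≤0 _ _ _ _ {r} {c} m∈ _ =
  ⊥-elim (ℕP.<⇒≱ (∈-length (∈-boxes⁺ λ′ ν (r , c) m∈)) #boxes≤0)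
boxX≡boxRHS (suc k) λ′ ν #boxes≤1+k ν-antitone bbs y y-inj {r} {c} m∈@(νr≤c , _) dull = by-boxes (boxes λ⁻ ν) refl
  where
  open RemoveDullBox λ′ ν ν-antitone bbs y y-inj (dull⇒lastInRow λ′ ν m∈ dull) νr≤c dull
  λ⁻ = shrinkRow λ′ r
  IH : ∀ {d} → d ∈ filterᵇ (dullᵇ λ⁻ ν) (boxes λ⁻ ν) → boxX (shrinkRow λ⁻ (proj₁ d)) ν d y ≡ boxRHS λ⁻ ν d y
  IH d∈ with ∈-filterᵇ⁻ (dullᵇ λ⁻ ν) (boxes λ⁻ ν) d∈
  ... | d∈B⁻ , dull-d = boxX≡boxRHS k λ⁻ ν
    (ℕP.≤-pred (ℕP.≤-trans (length-boxes-shrinkRow λ′ ν (dull⇒lastInRow λ′ ν m∈ dull) νr≤c) #boxes≤1+k))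
    ν-antitone (BrokenBorderStrip-shrinkRow λ′ ν r bbs) y (InjectiveOn-⊆ (boxes-shrinkRow-⊆ λ′ ν r) y-inj)
    (∈-boxes⁻ λ⁻ ν d∈B⁻) dull-d
  by-boxes : ∀ B → boxes λ⁻ ν ≡ B → boxX λ⁻ ν (r , c) y ≡ boxRHS λ′ ν (r , c) y
  by-boxes []      boxes⁻≡[]  = boxX-noBoxesLeft boxes⁻≡[]
  by-boxes (b ∷ _) boxes⁻≡b∷ = boxX-step (subst (b ∈_) (sym boxes⁻≡b∷) (here refl)) IH

-- From labels to boxes

chainProd-map : ∀ {A : Set} (x : ℕ → ℚ) (f : A → ℕ) ws → chainProd x (map f ws) ≡ chain (x ∘ f) ws
chainProd-map x f []           = refl
chainProd-map x f (a ∷ [])     = refl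
chainProd-map x f (a ∷ b ∷ ws) = cong ((x (f b) - x (f a)) *_) (chainProd-map x f (b ∷ ws))

boxes-upTo : ∀ λ′ ν d → boxes λ′ ν ≡ concatMap (rowBoxes λ′ ν) (upTo (d ℕ.+ length λ′))
boxes-upTo λ′ ν zero    = refl
boxes-upTo λ′ ν (suc d) = begin
  boxes λ′ ν
    ≡⟨ boxes-upTo λ′ ν d ⟩
  concatMap (rowBoxes λ′ ν) (upTo K)
    ≡⟨ ++-identityʳ _ ⟨
  concatMap (rowBoxes λ′ ν) (upTo K) ++ []
    ≡⟨ cong (λ bs → concatMap (rowBoxes λ′ ν) (upTo K) ++ bs ++ []) empty-row ⟨
  concatMap (rowBoxes λ′ ν) (upTo K) ++ concatMap (rowBoxes λ′ ν) (K ∷ [])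
    ≡⟨ concatMap-++ (rowBoxes λ′ ν) (upTo K) (K ∷ []) ⟨
  concatMap (rowBoxes λ′ ν) (upTo K ++ K ∷ [])
    ≡⟨ cong (concatMap (rowBoxes λ′ ν)) (upTo-∷ʳ K) ⟩
  concatMap (rowBoxes λ′ ν) (upTo (suc K)) ∎
  where
  K = d ℕ.+ length λ′
  empty-row : rowBoxes λ′ ν K ≡ []
  empty-row = cong (λ n → map (K ,_) (map (row ν K ℕ.+_) (upTo n)))
    (trans (cong (_∸ row ν K) (row-≥length λ′ (ℕP.m≤n+m (length λ′) d))) (ℕP.0∸n≡0 (row ν K)))

boxes-upTo-≥ : ∀ λ′ ν {K} → length λ′ ≤ K → boxes λ′ ν ≡ concatMap (rowBoxes λ′ ν) (upTo K)
boxes-upTo-≥ λ′ ν {K} len≤K =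
  trans (boxes-upTo λ′ ν (K ∸ length λ′)) (cong (concatMap (rowBoxes λ′ ν) ∘ upTo) (ℕP.m∸n+n≡m len≤K))

module _ (μ μ′ ν : List ℕ) (μ≗μ′ : ∀ r → row μ r ≡ row μ′ r) where

  boxes-cong : boxes μ ν ≡ boxes μ′ ν
  boxes-cong = begin
    boxes μ ν                            ≡⟨ boxes-upTo-≥ μ ν (ℕP.m≤m⊔n (length μ) (length μ′)) ⟩
    concatMap (rowBoxes μ ν) (upTo K)    ≡⟨ concatMap-cong (λ r → cong (map (r ,_) ∘ range (row ν r)) (μ≗μ′ r)) (upTo K) ⟩
    concatMap (rowBoxes μ′ ν) (upTo K)   ≡⟨ boxes-upTo-≥ μ′ ν (ℕP.m≤n⊔m (length μ) (length μ′)) ⟨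
    boxes μ′ ν                           ∎
    where
    K = length μ ℕ.⊔ length μ′

  inSkewᵇ-cong : ∀ b → inSkewᵇ μ ν b ≡ inSkewᵇ μ′ ν b
  inSkewᵇ-cong (r , c) = cong (λ n → (row ν r ≤ᵇ c) ∧ (c <ᵇ n)) (μ≗μ′ r)

  SYT-cong : SYT μ ν ≡ SYT μ′ ν
  SYT-cong = trans (filterᵇ-cong (perms (boxes μ ν)) (λ {w} _ → isStandardᵇ-cong w))
                   (cong (filterᵇ (isStandardᵇ μ′ ν) ∘ perms) boxes-cong)
    where
    isStandardᵇ-cong : ∀ w → isStandardᵇ μ ν w ≡ isStandardᵇ μ′ ν w
    isStandardᵇ-cong w = begin
      isStandardᵇ μ ν w                           ≡⟨ isStandardᵇ-all μ ν w ⟩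
      all (standardAtᵇ μ ν w) (boxes μ ν)         ≡⟨ cong (all (standardAtᵇ μ ν w)) boxes-cong ⟩
      all (standardAtᵇ μ ν w) (boxes μ′ ν)
        ≡⟨ all-cong (boxes μ′ ν) (λ {b} _ →
             cong₂ (λ p q → (not p ∨ (pos w b <ᵇ pos w (right b))) ∧ (not q ∨ (pos w b <ᵇ pos w (below b))))
                   (inSkewᵇ-cong (right b)) (inSkewᵇ-cong (below b))) ⟩
      all (standardAtᵇ μ′ ν w) (boxes μ′ ν)       ≡⟨ isStandardᵇ-all μ′ ν w ⟨
      isStandardᵇ μ′ ν w                          ∎

  boxX-cong : ∀ m y → boxX μ ν m y ≡ boxX μ′ ν m y
  boxX-cong m y = cong (sumℚ ∘ map (λ w → inv (chain y (w ++ m ∷ [])))) SYT-cong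

label-range : ∀ λ′ ν {b} → b ∈ boxes λ′ ν → 1 ≤ label λ′ ν b × label λ′ ν b ≤ length (boxes λ′ ν)
label-range λ′ ν b∈ with pos-∈ (boxes λ′ ν) b∈
... | k , label≡1+k , k<n = subst (1 ≤_) (sym label≡1+k) (s≤s z≤n) , subst (_≤ length (boxes λ′ ν)) (sym label≡1+k) k<n

InjectiveOn-label : ∀ λ′ ν (x : ℕ → ℚ) →
  (∀ i j → 1 ≤ i → i ≤ length (boxes λ′ ν) → 1 ≤ j → j ≤ length (boxes λ′ ν) → i ≢ j → x i ≢ x j) →
  InjectiveOn (x ∘ label λ′ ν) (boxes λ′ ν)
InjectiveOn-label λ′ ν x x-inj {a} {b} a∈ b∈ xa≡xb with a ≟B b
... | yes a≡b = a≡b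
... | no  a≢b = ⊥-elim (x-inj (label λ′ ν a) (label λ′ ν b)
                          (proj₁ (label-range λ′ ν a∈)) (proj₂ (label-range λ′ ν a∈))
                          (proj₁ (label-range λ′ ν b∈)) (proj₂ (label-range λ′ ν b∈))
                          (a≢b ∘ pos-injective (boxes λ′ ν) a∈ b∈) xa≡xb)

X≡boxX : ∀ λ′ μ ν m x → X λ′ μ ν (label λ′ ν m) x ≡ boxX μ ν m (x ∘ label λ′ ν)
X≡boxX λ′ μ ν m x = cong sumℚ (map-cong (λ w → cong inv (trans
  (cong (chainProd x) (sym (map-++ (label λ′ ν) w (m ∷ [])))) (chainProd-map x (label λ′ ν) (w ++ m ∷ [])))) (SYT μ ν))

RHS≡boxRHS : ∀ λ′ ν {m} x → m ∈ boxes λ′ ν → RHS λ′ ν (label λ′ ν m) x ≡ boxRHS λ′ ν m (x ∘ label λ′ ν)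
RHS≡boxRHS λ′ ν {m} x m∈ =
  cong₂ _*_ (cong₂ (λ p q → p * inv q) (prod-∘ S (λ s → x ℓ - x s)) dull-part)
            (cong inv (cong₂ _*_ (prod-∘ (filterᵇ (λ b → inSkewᵇ λ′ ν (right b)) B) (λ p → x (proj₂ p) - x (proj₁ p)))
                                 (prod-∘ (filterᵇ (λ b → inSkewᵇ λ′ ν (below b)) B) (λ p → x (proj₂ p) - x (proj₁ p)))))
  where
  B = boxes λ′ ν
  S = filterᵇ (sharpᵇ λ′ ν) B
  D = filterᵇ (dullᵇ λ′ ν) B
  lab = label λ′ ν
  ℓ = lab m
  prod-∘ : ∀ {A C : Set} (xs : List A) {g : A → C} (f : C → ℚ) → prodℚ (map f (map g xs)) ≡ prodℚ (map (f ∘ g) xs)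
  prod-∘ xs f = cong prodℚ (sym (map-∘ xs))
  same-label : ∀ {d} → d ∈ D → not (lab d ℕ.≡ᵇ ℓ) ≡ d ≢ᵇ m
  same-label {d} d∈ = does-⇔
    (mk⇔ (λ ℓd≢ℓ d≡m → ℓd≢ℓ (cong lab d≡m))
         (λ d≢m → d≢m ∘ pos-injective B (proj₁ (∈-filterᵇ⁻ (dullᵇ λ′ ν) B d∈)) m∈))
    (¬? (lab d ℕ.≟ ℓ)) (¬? (d ≟B m))
  dull-part : prodℚ (map (λ d → x ℓ - x d) (filterᵇ (λ d → not (d ℕ.≡ᵇ ℓ)) (map lab D)))
              ≡ prodℚ (map (λ d → x ℓ - x (lab d)) (filterᵇ (_≢ᵇ m) D))
  dull-part = begin
    prodℚ (map (λ d → x ℓ - x d) (filterᵇ (λ d → not (d ℕ.≡ᵇ ℓ)) (map lab D)))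
      ≡⟨ cong (prodℚ ∘ map (λ d → x ℓ - x d)) (filterᵇ-map (λ d → not (d ℕ.≡ᵇ ℓ)) lab D) ⟩
    prodℚ (map (λ d → x ℓ - x d) (map lab (filterᵇ (λ d → not (lab d ℕ.≡ᵇ ℓ)) D)))
      ≡⟨ cong (λ ds → prodℚ (map (λ d → x ℓ - x d) (map lab ds))) (filterᵇ-cong D same-label) ⟩
    prodℚ (map (λ d → x ℓ - x d) (map lab (filterᵇ (_≢ᵇ m) D)))
      ≡⟨ prod-∘ (filterᵇ (_≢ᵇ m) D) (λ d → x ℓ - x d) ⟩
    prodℚ (map (λ d → x ℓ - x (lab d)) (filterᵇ (_≢ᵇ m) D)) ∎

AddsBoxAt⇒row-shrinkRow : ∀ μ λ′ r → AddsBoxAt μ λ′ r → ∀ r′ → row μ r′ ≡ row (shrinkRow λ′ r) r′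
AddsBoxAt⇒row-shrinkRow μ λ′ r (λr≡1+μr , λ≡μ-elsewhere) r′ with r′ ℕ.≟ r
... | yes refl = sym (trans (row-shrinkRow-≡ λ′ r) (cong pred λr≡1+μr))
... | no r′≢r  = sym (trans (row-shrinkRow-≢ λ′ r′≢r) (λ≡μ-elsewhere r′ r′≢r))

theorem4p3 : (λ′ μ ν : List ℕ) (r : ℕ) →
    IsPartition λ′ → IsPartition μ → IsPartition ν →
    ν ⊆Y μ → AddsBoxAt μ λ′ r → BrokenBorderStrip λ′ ν →
    (x : ℕ → ℚ) →
    (∀ i j → 1 ≤ i → i ≤ length (boxes λ′ ν) → 1 ≤ j → j ≤ length (boxes λ′ ν) →
      i ≢ j → x i ≢ x j) →
    X λ′ μ ν (label λ′ ν (r , row μ r)) x ≡ RHS λ′ ν (label λ′ ν (r , row μ r)) x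
theorem4p3 λ′ μ ν r _ (μ-antitone , _) (ν-antitone , _) ν⊆μ μ↗λ bbs x x-inj = begin
  X λ′ μ ν (label λ′ ν m) x     ≡⟨ X≡boxX λ′ μ ν m x ⟩
  boxX μ ν m y                  ≡⟨ boxX-cong μ (shrinkRow λ′ r) ν (AddsBoxAt⇒row-shrinkRow μ λ′ r μ↗λ) m y ⟩
  boxX (shrinkRow λ′ r) ν m y   ≡⟨ boxX≡boxRHS (length (boxes λ′ ν)) λ′ ν ℕP.≤-refl ν-antitone bbs
                                    y (InjectiveOn-label λ′ ν x x-inj) m∈λ/ν m-dull ⟩
  boxRHS λ′ ν m y               ≡⟨ RHS≡boxRHS λ′ ν x (∈-boxes⁺ λ′ ν m m∈λ/ν) ⟨
  RHS λ′ ν (label λ′ ν m) x     ∎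
  where
  m = (r , row μ r)
  y = x ∘ label λ′ ν
  λr≡1+μr = proj₁ μ↗λ
  m∈λ/ν : InSkew λ′ ν m
  m∈λ/ν = ν⊆μ r , subst (row μ r <_) (sym λr≡1+μr) (ℕP.n<1+n (row μ r))
  m-dull : dullᵇ λ′ ν m ≡ true
  m-dull = lastInRow-dull λ′ ν λr≡1+μr
    (ℕP.≤-trans (ℕP.≤-reflexive (proj₂ μ↗λ (suc r) ℕP.1+n≢n)) (μ-antitone r))
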